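{- Let $d\ge1$ and $n\ge1$. The cardinality of $\mathrm{NC}^d_n$ equals the number of rooted plane trees on $n+1$ vertices such that the degree (number of incident edges) of each vertex is congruent to $1$ modulo $d$.
   Context: A partition of $[n]$ is noncrossing if there are no $i<j<k<\ell$ with $i,k$ in one block and $j,\ell$ in a different block. The Kreweras dual $\pi'$ of a noncrossing partition $\pi$ of $[n]$: place $1,1',2,2',\dots,n,n'$ on a circle in this cyclic order; $\pi'$ is the coarsest partition of $\{1',\dots,n'\}$ such that the blocks of $\pi$ and of $\pi'$ together form a noncrossing partition of these $2n$ points. $\mathrm{NC}^d_n$ is the set of noncrossing partitions $\pi$ of $[n]$ such that every block of $\pi$ and every block of $\pi'$ has cardinality congruent to $1$ modulo $d$. A rooted plane tree is a rooted tree in which the children of each vertex are linearly ordered. -}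

module Defs where

open import Data.Nat using (ℕ; zero; suc; _+_; _*_; _<_)
open import Data.Bool using (Bool; true; false)
open import Data.Fin using (Fin; toℕ)
open import Data.Vec using (Vec; lookup; []; _∷_)
open import Data.List using (List; []; _∷_; length)
open import Data.Product using (Σ; _×_; ∃-syntax)
open import Data.Empty using (⊥)
open import Data.Refinement using (Refinement)
open import Relation.Binary.PropositionalEquality using (_≡_)

Cong1 : ℕ → ℕ → Set
Cong1 d m = ∃[ k ] m ≡ 1 + k * d

-- Set partitions of Fin n, given by their (boolean) relation matrix
-- "i and j lie in the same block".

Matrix : ℕ → Set
Matrix n = Vec (Vec Bool n) n

Rel : ∀ {n} → Matrix n → Fin n → Fin n → Set
Rel R i j = lookup (lookup R i) j ≡ true

IsPartition : ∀ {n} → Matrix n → Set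
IsPartition R =
  (∀ i → Rel R i i) ×
  (∀ i j → Rel R i j → Rel R j i) ×
  (∀ i j k → Rel R i j → Rel R j k → Rel R i k)

countTrue : ∀ {m} → Vec Bool m → ℕ
countTrue []           = 0
countTrue (true ∷ bs)  = suc (countTrue bs)
countTrue (false ∷ bs) = countTrue bs

blockSize : ∀ {n} → Matrix n → Fin n → ℕ
blockSize R i = countTrue (lookup R i)

BlocksOK : ∀ {n} → ℕ → Matrix n → Set
BlocksOK d R = ∀ i → Cong1 d (blockSize R i)

-- Noncrossing condition for a relation on points placed in linear order
-- by pos: no a<b<c<e with a,c in one block and b,e in another.
NoncrossingOn : {A : Set} → (A → ℕ) → (A → A → Set) → Set
NoncrossingOn {A} pos rel =
  ∀ (a b c e : A) → pos a < pos b → pos b < pos c → pos c < pos e →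
  rel a c → rel b e → rel a b

Noncrossing : ∀ {n} → Matrix n → Set
Noncrossing R = NoncrossingOn toℕ (Rel R)

-- Kreweras dual.  The 2n points 1,1',2,2',...,n,n' are (i , false) for i
-- and (i , true) for i', placed at positions 2i and 2i+1 (0-indexed).

Point : ℕ → Set
Point n = Fin n × Bool

pos : ∀ {n} → Point n → ℕ
pos (i Data.Product., false) = 2 * toℕ i
pos (i Data.Product., true)  = suc (2 * toℕ i)

Comb : ∀ {n} → Matrix n → Matrix n → Point n → Point n → Set
Comb π σ (i Data.Product., false) (j Data.Product., false) = Rel π i j
Comb π σ (i Data.Product., true)  (j Data.Product., true)  = Rel σ i j
Comb π σ (_ Data.Product., false) (_ Data.Product., true)  = ⊥
Comb π σ (_ Data.Product., true)  (_ Data.Product., false) = ⊥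

Refines : ∀ {n} → Matrix n → Matrix n → Set
Refines σ' σ = ∀ i j → Rel σ' i j → Rel σ i j

IsKreweras : ∀ {n} → Matrix n → Matrix n → Set
IsKreweras π σ =
  IsPartition σ × NoncrossingOn pos (Comb π σ) ×
  (∀ σ' → IsPartition σ' → NoncrossingOn pos (Comb π σ') → Refines σ' σ)

-- NC^d_n (proof component irrelevant, so elements are just matrices)
NCd : ℕ → ℕ → Set
NCd d n = Refinement (Matrix n) λ π →
  IsPartition π × Noncrossing π × BlocksOK d π ×
  (∃[ σ ] (IsKreweras π σ × BlocksOK d σ))

data Tree : Set where
  node : List Tree → Tree

mutual
  size : Tree → ℕ
  size (node ts) = suc (sizes ts)

  sizes : List Tree → ℕ
  sizes []       = 0
  sizes (t ∷ ts) = size t + sizes ts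

-- every non-root vertex of the forest (children + 1 parent edge) has
-- degree ≡ 1 mod d
mutual
  data NonRootOK (d : ℕ) : Tree → Set where
    node : ∀ {ts} → Cong1 d (suc (length ts)) → AllNonRootOK d ts →
           NonRootOK d (node ts)

  data AllNonRootOK (d : ℕ) : List Tree → Set where
    []  : AllNonRootOK d []
    _∷_ : ∀ {t ts} → NonRootOK d t → AllNonRootOK d ts → AllNonRootOK d (t ∷ ts)

-- every vertex (root: degree = number of children) has degree ≡ 1 mod d
data DegOK (d : ℕ) : Tree → Set where
  node : ∀ {ts} → Cong1 d (length ts) → AllNonRootOK d ts → DegOK d (node ts)

PlaneTrees : ℕ → ℕ → Set
PlaneTrees d n = Refinement Tree λ t → size t ≡ suc n × DegOK d t

-- A plane tree with n + 1 vertices is encoded by its contour walk, a Dyck path h of length 2n,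
-- and two times p, q of the walk are at the same vertex iff h p = h q and h ≥ h p in between.
-- On the even times 0, 2, …, 2n − 2 this relation is a noncrossing partition π of [n]; on the
-- odd times it is the Kreweras dual of π, since it is noncrossing together with π and any two
-- odd times at different vertices are separated by a vertex visited at two even times crossing
-- them.  A vertex of degree k is visited exactly k times before time 2n (the root once before
-- each child, any other vertex once per incident edge), so the degree condition on the tree is
-- the block-size condition on π and its dual.  Conversely every noncrossing partition is read
-- off exactly one Dyck path, whose steps are forced by where its blocks open and close.

module Submission where

open import Defs
open import Data.Nat using (ℕ; _≤_)
open import Function.Bundles using (_↔_; mk↔ₛ′)

open import Data.Nat
open import Data.Nat.Properties
open import Data.Nat.Tactic.RingSolver using (solve-∀)
open import Data.Bool using (Bool; true; false; if_then_else_)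
import Data.Bool.Properties as Bool
open import Data.Parity.Base using (Parity; 0ℙ; 1ℙ; _⁻¹)
open import Data.Parity.Properties using (suc-homo-⁻¹; ⁻¹-selfInverse; p≢p⁻¹)
open import Data.List using (List; []; _∷_; length)
open import Data.Fin using (Fin; toℕ; fromℕ<) renaming (zero to fzero; suc to fsuc)
open import Data.Fin.Properties using (toℕ-fromℕ<; toℕ<n)
open import Data.Vec using (Vec; []; _∷_; lookup; tabulate; replicate)
open import Data.Vec.Properties using (lookup∘tabulate; tabulate∘lookup; tabulate-cong; ≡-dec)
open import Data.Product
open import Data.Sum using (_⊎_; inj₁; inj₂; [_,_]′)
open import Data.Empty using (⊥; ⊥-elim)
open import Data.Irrelevant using ([_])
open import Data.Refinement using (Refinement; _,_; value-injective)
open import Function using (_∘_; case_of_)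
open import Function.Bundles using (_⇔_; mk⇔)
open import Relation.Nullary
open import Relation.Nullary.Decidable
  using (dec-true; dec-false; does-⇔; recompute; map′; decidable-stable; _×-dec_; _⊎-dec_; _→-dec_)
import Relation.Unary as U
open import Relation.Binary.PropositionalEquality
open import Relation.Binary.Definitions using (tri<; tri≈; tri>)

double : ℕ → ℕ
double zero    = zero
double (suc n) = suc (suc (double n))

data ParityView : ℕ → Set where
  even : ∀ i → ParityView (double i)
  odd  : ∀ i → ParityView (suc (double i))

parityView : ∀ p → ParityView p
parityView zero          = even 0
parityView (suc zero)    = odd 0
parityView (suc (suc p)) with parityView p
... | even i = even (suc i)
... | odd i  = odd (suc i)

parity-suc : ∀ n → parity (suc n) ≡ parity n ⁻¹
parity-suc n = sym (⁻¹-selfInverse (suc-homo-⁻¹ n))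

parity-double : ∀ i → parity (double i) ≡ 0ℙ
parity-double zero    = refl
parity-double (suc i) = parity-double i

parity-suc-double : ∀ i → parity (suc (double i)) ≡ 1ℙ
parity-suc-double zero    = refl
parity-suc-double (suc i) = parity-suc-double i

parity-pred : ∀ {x v} → x ≡ suc v → parity v ≡ parity x ⁻¹
parity-pred {v = v} refl = sym (suc-homo-⁻¹ v)

2*≡double : ∀ i → 2 * i ≡ double i
2*≡double zero    = refl
2*≡double (suc i) = cong suc (trans (+-suc i (i + 0)) (cong suc (2*≡double i)))

double-+ : ∀ a b → double (a + b) ≡ double a + double b
double-+ zero    b = refl
double-+ (suc a) b = cong (suc ∘ suc) (double-+ a b)

double-mono-≤ : ∀ {i j} → i ≤ j → double i ≤ double j
double-mono-≤ z≤n       = z≤n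
double-mono-≤ (s≤s i≤j) = s≤s (s≤s (double-mono-≤ i≤j))

double-mono-< : ∀ {i j} → i < j → double i < double j
double-mono-< (s≤s i≤j) = s≤s (m≤n⇒m≤1+n (double-mono-≤ i≤j))

double-cancel-≤ : ∀ {i j} → double i ≤ suc (double j) → i ≤ j
double-cancel-≤ {zero}          _              = z≤n
double-cancel-≤ {suc i} {suc j} (s≤s (s≤s le)) = s≤s (double-cancel-≤ le)

double-cancel-< : ∀ {i j} → suc (double i) ≤ double j → i < j
double-cancel-< {i} {suc j} (s≤s le) = s≤s (double-cancel-≤ le)

double-injective : ∀ {i j} → double i ≡ double j → i ≡ j
double-injective {zero}  {zero}  _ = refl
double-injective {suc i} {suc j} e = cong suc (double-injective (suc-injective (suc-injective e)))

even⇒double : ∀ {p} → parity p ≡ 0ℙ → ∃ λ i → p ≡ double i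
even⇒double {p} p-even with parityView p
... | even i = i , refl
... | odd i  with () ← trans (sym p-even) (parity-suc-double i)

interleave : (ℕ → ℕ) → (ℕ → ℕ) → ℕ → ℕ
interleave f g zero          = f 0
interleave f g (suc zero)    = g 0
interleave f g (suc (suc p)) = interleave (f ∘ suc) (g ∘ suc) p

interleave-double : ∀ f g i → interleave f g (double i) ≡ f i
interleave-double f g zero    = refl
interleave-double f g (suc i) = interleave-double (f ∘ suc) (g ∘ suc) i

interleave-suc-double : ∀ f g i → interleave f g (suc (double i)) ≡ g i
interleave-suc-double f g zero    = refl
interleave-suc-double f g (suc i) = interleave-suc-double (f ∘ suc) (g ∘ suc) i

module _ {P : ℕ → Set} (P? : U.Decidable P) where

  leastWitness : ∀ {k} → P k → ∃ λ m → m ≤ k × P m × (∀ j → j < m → ¬ P j)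
  leastWitness {k} pk = search k (k , ≤-refl , pk)
    where
    search : ∀ k → (∃ λ j → j ≤ k × P j) → ∃ λ m → m ≤ k × P m × (∀ j → j < m → ¬ P j)
    search zero (j , j≤0 , pj) = 0 , z≤n , subst P (n≤0⇒n≡0 j≤0) pj , λ _ ()
    search (suc k) (j , j≤1+k , pj) with anyUpTo? P? (suc k)
    ... | yes (i , s≤s i≤k , pi) =
      let m , m≤k , pm , below = search k (i , i≤k , pi) in m , m≤n⇒m≤1+n m≤k , pm , below
    ... | no none with m≤n⇒m<n∨m≡n j≤1+k
    ...   | inj₁ j<1+k = ⊥-elim (none (j , j<1+k , pj))
    ...   | inj₂ refl  = j , ≤-refl , pj , λ i i<j pi → none (i , i<j , pi)

  greatestBelow : ∀ {j} k → j < k → P j → ∃ λ m → j ≤ m × m < k × P m × (∀ i → m < i → i < k → ¬ P i)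
  greatestBelow (suc k) (s≤s j≤k) pj with P? k
  ... | yes pk = k , j≤k , ≤-refl , pk , λ i k<i i<1+k → ⊥-elim (<⇒≱ k<i (s≤s⁻¹ i<1+k))
  ... | no ¬pk =
    let m , j≤m , m<k , pm , above = greatestBelow k (≤∧≢⇒< j≤k λ { refl → ¬pk pj }) pj
    in m , j≤m , m≤n⇒m≤1+n m<k , pm ,
       λ i m<i i<1+k → [ above i m<i , (λ { refl → ¬pk }) ]′ (m<1+n⇒m<n∨m≡n i<1+k)

  allInRange⊎counterexample : ∀ p q → (∀ s → p ≤ s → s ≤ q → P s) ⊎ (∃ λ s → p ≤ s × s ≤ q × ¬ P s)
  allInRange⊎counterexample p q with anyUpTo? (λ s → (p ≤? s) ×-dec ¬? (P? s)) (suc q)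
  ... | yes (s , s≤s s≤q , p≤s , ¬ps) = inj₂ (s , p≤s , s≤q , ¬ps)
  ... | no none = inj₁ λ s p≤s s≤q → decidable-stable (P? s) λ ¬ps → none (s , s≤s s≤q , p≤s , ¬ps)

-- Dyck paths, as height functions

Step : (ℕ → ℕ) → ℕ → Set
Step h p = h (suc p) ≡ suc (h p) ⊎ h p ≡ suc (h (suc p))

record IsDyck (h : ℕ → ℕ) (N : ℕ) : Set where
  field
    start : h 0 ≡ 0
    end   : h N ≡ 0
    step  : ∀ p → p < N → Step h p
open IsDyck public

step-parity : ∀ {h p} → Step h p → parity (h (suc p)) ≡ parity (h p) ⁻¹
step-parity {h} {p} (inj₁ up)   = trans (cong parity up) (parity-suc (h p))
step-parity {h} {p} (inj₂ down) = sym (⁻¹-selfInverse (sym (trans (cong parity down) (parity-suc (h (suc p))))))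

height-parity : ∀ {h N} → IsDyck h N → ∀ p → p ≤ N → parity (h p) ≡ parity p
height-parity {h} D zero    _   = cong parity (start D)
height-parity {h} D (suc p) p<N =
  trans (step-parity {h} (step D p p<N)) (trans (cong _⁻¹ (height-parity D p (<⇒≤ p<N))) (sym (parity-suc p)))

step-upcrossing : ∀ {h p v} → Step h p → h p ≤ v → v < h (suc p) → h p ≡ v
step-upcrossing (inj₁ up)   hp≤v v<h′ = ≤-antisym hp≤v (s≤s⁻¹ (subst (_ <_) up v<h′))
step-upcrossing {h} {p} (inj₂ down) hp≤v v<h′ =
  ⊥-elim (<⇒≱ (<-trans v<h′ (subst (h (suc p) <_) (sym down) (n<1+n _))) hp≤v)

step-downcrossing : ∀ {h p v} → Step h p → v < h p → h (suc p) ≤ v → h (suc p) ≡ v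
step-downcrossing {h} {p} (inj₁ up) v<h h′≤v =
  ⊥-elim (<⇒≱ (<-≤-trans v<h (subst (h p ≤_) (sym up) (n≤1+n _))) h′≤v)
step-downcrossing (inj₂ down) v<h h′≤v = ≤-antisym h′≤v (s≤s⁻¹ (subst (_ <_) down v<h))

module _ {h : ℕ → ℕ} {N : ℕ} (D : IsDyck h N) where

  lastVisit : ∀ {v x t} → t ≤ N → x ≤ t → h x ≤ v → v < h t →
              ∃ λ a → x ≤ a × a < t × h a ≡ v × (∀ s → a < s → s ≤ t → v < h s)
  lastVisit {v} {x} {t} t≤N x≤t hx≤v v<ht
    with greatestBelow (λ s → h s ≤? v) t (≤∧≢⇒< x≤t λ { refl → <⇒≱ v<ht hx≤v }) hx≤v
  ... | a , x≤a , a<t , ha≤v , noneAfter =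
    a , x≤a , a<t , step-upcrossing {h} (step D a (<-≤-trans a<t t≤N)) ha≤v (above (suc a) ≤-refl a<t) , above
    where
    above : ∀ s → a < s → s ≤ t → v < h s
    above s a<s s≤t with m≤n⇒m<n∨m≡n s≤t
    ... | inj₁ s<t  = ≰⇒> (noneAfter s a<s s<t)
    ... | inj₂ refl = v<ht

  firstVisit : ∀ {v t y} → y ≤ N → t ≤ y → v < h t → h y ≤ v →
               ∃ λ b → t < b × b ≤ y × h b ≡ v × (∀ s → t ≤ s → s < b → v < h s)
  firstVisit {v} {t} {y} y≤N t≤y v<ht hy≤v
    with leastWitness (λ s → (t <? s) ×-dec (h s ≤? v)) (≤∧≢⇒< t≤y (λ { refl → <⇒≱ v<ht hy≤v }) , hy≤v)
  ... | b , b≤y , (t<b , hb≤v) , noneBefore = b , t<b , b≤y , crossing t<b b≤y hb≤v above , above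
    where
    above : ∀ s → t ≤ s → s < b → v < h s
    above s t≤s s<b with m≤n⇒m<n∨m≡n t≤s
    ... | inj₁ t<s  = ≰⇒> λ hs≤v → noneBefore s s<b (t<s , hs≤v)
    ... | inj₂ refl = v<ht
    crossing : ∀ {b} → t < b → b ≤ y → h b ≤ v → (∀ s → t ≤ s → s < b → v < h s) → h b ≡ v
    crossing {suc b′} (s≤s t≤b′) b≤y hb≤v above′ =
      step-downcrossing {h} (step D b′ (≤-trans b≤y y≤N)) (above′ b′ t≤b′ ≤-refl) hb≤v

Between : ℕ → ℕ → ℕ → Set
Between p s q = (p ≤ s × s ≤ q) ⊎ (q ≤ s × s ≤ p)

-- For the contour walk of a plane tree these are exactly the pairs of
-- times at which the walk is at the same vertex.
SameVertex : (ℕ → ℕ) → ℕ → ℕ → Set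
SameVertex h p q = h p ≡ h q × (∀ s → Between p s q → h p ≤ h s)

between-ordered : ∀ {p s q} → p ≤ q → Between p s q → p ≤ s × s ≤ q
between-ordered p≤q (inj₁ p≤s≤q)       = p≤s≤q
between-ordered p≤q (inj₂ (q≤s , s≤p)) = ≤-trans p≤q q≤s , ≤-trans s≤p p≤q

between-sym : ∀ {p s q} → Between p s q → Between q s p
between-sym (inj₁ b) = inj₂ b
between-sym (inj₂ b) = inj₁ b

between? : ∀ p s q → Dec (Between p s q)
between? p s q = ((p ≤? s) ×-dec (s ≤? q)) ⊎-dec ((q ≤? s) ×-dec (s ≤? p))

between-< : ∀ {p s q} → Between p s q → s < suc (p ⊔ q)
between-< {p} {s} {q} (inj₁ (_ , s≤q)) = s≤s (≤-trans s≤q (m≤n⊔m p q))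
between-< {p} {s} {q} (inj₂ (_ , s≤p)) = s≤s (≤-trans s≤p (m≤m⊔n p q))

between-shift : ∀ c {i s j} → Between i s j → Between (c + i) (c + s) (c + j)
between-shift c (inj₁ (i≤s , s≤j)) = inj₁ (+-monoʳ-≤ c i≤s , +-monoʳ-≤ c s≤j)
between-shift c (inj₂ (j≤s , s≤i)) = inj₂ (+-monoʳ-≤ c j≤s , +-monoʳ-≤ c s≤i)

between-unshift : ∀ c {i s j} → Between (c + i) s (c + j) → ∃ λ t → s ≡ c + t × Between i t j
between-unshift c {i} {s} {j} (inj₁ (c+i≤s , s≤c+j)) =
  let o , c+i+o≡s = m≤n⇒∃[o]m+o≡n c+i≤s
      s≡c+t       = trans (sym c+i+o≡s) (+-assoc c i o)
  in i + o , s≡c+t , inj₁ (m≤m+n i o , +-cancelˡ-≤ c _ _ (subst (_≤ c + j) s≡c+t s≤c+j))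
between-unshift c (inj₂ b) =
  let t , s≡c+t , btw = between-unshift c (inj₁ b) in t , s≡c+t , between-sym btw

module _ (h : ℕ → ℕ) where

  sameVertex-refl : ∀ p → SameVertex h p p
  sameVertex-refl p = refl , λ s btw →
    let p≤s , s≤p = between-ordered ≤-refl btw in ≤-reflexive (cong h (≤-antisym p≤s s≤p))

  sameVertex-sym : ∀ {p q} → SameVertex h p q → SameVertex h q p
  sameVertex-sym (hp≡hq , low) = sym hp≡hq , λ s btw → subst (_≤ h s) hp≡hq (low s (between-sym btw))

  sameVertex-trans : ∀ {p q r} → SameVertex h p q → SameVertex h q r → SameVertex h p r
  sameVertex-trans {p} {q} {r} (hp≡hq , low₁) (hq≡hr , low₂) = trans hp≡hq hq≡hr , low
    where
    low : ∀ s → Between p s r → h p ≤ h s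
    low s (inj₁ (p≤s , s≤r)) with s ≤? q
    ... | yes s≤q = low₁ s (inj₁ (p≤s , s≤q))
    ... | no s≰q  = subst (_≤ h s) (sym hp≡hq) (low₂ s (inj₁ (<⇒≤ (≰⇒> s≰q) , s≤r)))
    low s (inj₂ (r≤s , s≤p)) with q ≤? s
    ... | yes q≤s = low₁ s (inj₂ (q≤s , s≤p))
    ... | no q≰s  = subst (_≤ h s) (sym hp≡hq) (low₂ s (inj₂ (r≤s , <⇒≤ (≰⇒> q≰s))))

  sameVertex-noncrossing : ∀ {a b c e} → a ≤ b → b ≤ c → c ≤ e →
                           SameVertex h a c → SameVertex h b e → SameVertex h a b
  sameVertex-noncrossing {a} {b} {c} a≤b b≤c c≤e (ha≡hc , low₁) (hb≡he , low₂) =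
    ≤-antisym (low₁ b (inj₁ (a≤b , b≤c))) (subst (h b ≤_) (sym ha≡hc) (low₂ c (inj₁ (b≤c , c≤e)))) ,
    λ s btw → let a≤s , s≤b = between-ordered a≤b btw in low₁ s (inj₁ (a≤s , ≤-trans s≤b b≤c))

  sameVertex-blocked : ∀ {p q s} → Between p s q → h s < h p → ¬ SameVertex h p q
  sameVertex-blocked btw hs<hp (_ , low) = <⇒≱ hs<hp (low _ btw)

  sameVertex-ground : ∀ {p q} → h p ≡ 0 → h q ≡ 0 → SameVertex h p q
  sameVertex-ground hp≡0 hq≡0 = trans hp≡0 (sym hq≡0) , λ s _ → subst (_≤ h s) (sym hp≡0) z≤n

  sameVertex-bridge : ∀ {a m b v} → a ≤ m → m ≤ b → h a ≡ v → h b ≡ v →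
                      (∀ s → a < s → s ≤ m → v < h s) → (∀ s → m ≤ s → s < b → v < h s) →
                      SameVertex h a b
  sameVertex-bridge {a} {m} {b} {v} a≤m m≤b ha≡v hb≡v left right =
    trans ha≡v (sym hb≡v) , λ s btw → low s (between-ordered (≤-trans a≤m m≤b) btw)
    where
    above⇒low : ∀ {s} → v < h s → h a ≤ h s
    above⇒low v<hs = subst (_≤ _) (sym ha≡v) (<⇒≤ v<hs)
    low : ∀ s → a ≤ s × s ≤ b → h a ≤ h s
    low s (a≤s , s≤b) with m≤n⇒m<n∨m≡n a≤s | s ≤? m | m≤n⇒m<n∨m≡n s≤b
    ... | inj₂ refl | _        | _         = ≤-refl
    ... | inj₁ a<s  | yes s≤m  | _         = above⇒low (left s a<s s≤m)
    ... | inj₁ _    | no s≰m   | inj₁ s<b  = above⇒low (right s (<⇒≤ (≰⇒> s≰m)) s<b)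
    ... | inj₁ _    | no _     | inj₂ refl = ≤-reflexive (trans ha≡v (sym hb≡v))

  sameVertex? : ∀ p q → Dec (SameVertex h p q)
  sameVertex? p q = (h p ≟ h q) ×-dec map′ (λ low s btw → low {s} (between-< btw) btw) (λ low {s} _ → low s)
                                           (allUpTo? (λ s → between? p s q →-dec (h p ≤? h s)) (suc (p ⊔ q)))

sameVertex-shift : ∀ {h g c k K i j} → (∀ s → s ≤ K → h (c + s) ≡ k + g s) → i ≤ K → j ≤ K →
                   SameVertex h (c + i) (c + j) ⇔ SameVertex g i j
sameVertex-shift {h} {g} {c} {k} {K} {i} {j} h≡k+g i≤K j≤K = mk⇔ unshift shift
  where
  bounded : ∀ {s} → Between i s j → s ≤ K
  bounded (inj₁ (_ , s≤j)) = ≤-trans s≤j j≤K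
  bounded (inj₂ (_ , s≤i)) = ≤-trans s≤i i≤K
  unshift : SameVertex h (c + i) (c + j) → SameVertex g i j
  unshift (hi≡hj , low) =
    +-cancelˡ-≡ k _ _ (trans (sym (h≡k+g i i≤K)) (trans hi≡hj (h≡k+g j j≤K))) ,
    λ s btw → +-cancelˡ-≤ k _ _ (subst₂ _≤_ (h≡k+g i i≤K) (h≡k+g s (bounded btw)) (low (c + s) (between-shift c btw)))
  shift : SameVertex g i j → SameVertex h (c + i) (c + j)
  shift (gi≡gj , low) =
    trans (h≡k+g i i≤K) (trans (cong (k +_) gi≡gj) (sym (h≡k+g j j≤K))) , λ s btw → low′ (between-unshift c btw)
    where
    low′ : ∀ {s} → (∃ λ t → s ≡ c + t × Between i t j) → h (c + i) ≤ h s
    low′ (t , refl , btw) = subst₂ _≤_ (sym (h≡k+g i i≤K)) (sym (h≡k+g t (bounded btw))) (+-monoʳ-≤ k (low t btw))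

sameVertexᵇ : (ℕ → ℕ) → ℕ → ℕ → Bool
sameVertexᵇ h p q = does (sameVertex? h p q)

sameVertexᵇ-shift : ∀ h g {c k K i j} → (∀ s → s ≤ K → h (c + s) ≡ k + g s) → i ≤ K → j ≤ K →
                    sameVertexᵇ h (c + i) (c + j) ≡ sameVertexᵇ g i j
sameVertexᵇ-shift h g h≡k+g i≤K j≤K = does-⇔ (sameVertex-shift h≡k+g i≤K j≤K) (sameVertex? h _ _) (sameVertex? g _ _)

sameVertexᵇ-ground : ∀ h {p q} → h p ≡ 0 → sameVertexᵇ h p q ≡ does (h q ≟ 0)
sameVertexᵇ-ground h {p} {q} hp≡0 =
  does-⇔ (mk⇔ (λ (hp≡hq , _) → trans (sym hp≡hq) hp≡0) (sameVertex-ground h hp≡0)) (sameVertex? h p q) (h q ≟ 0)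

Crossing : ℕ → ℕ → ℕ → ℕ → Set
Crossing a b p q = (a < p × p < b × b < q) ⊎ (p < a × a < q × q < b)

module _ {h : ℕ → ℕ} {N : ℕ} (D : IsDyck h N) where

  sameVertex-parity : ∀ {p q} → p ≤ N → q ≤ N → SameVertex h p q → parity p ≡ parity q
  sameVertex-parity {p} {q} p≤N q≤N (hp≡hq , _) =
    trans (sym (height-parity D p p≤N)) (trans (cong parity hp≡hq) (height-parity D q q≤N))

  -- The pair a, b is found at the level just below h p (if the walk dips
  -- below h p between p and q) or just below h q (otherwise).
  separatingVisits : ∀ {p q} → p < q → q < N → 1 ≤ h p → parity (h p) ≡ parity (h q) → ¬ SameVertex h p q →
                     ∃₂ λ a b → SameVertex h a b × b < N × parity (h a) ≡ parity (h p) ⁻¹ × Crossing a b p q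
  separatingVisits {p} {q} p<q q<N 1≤hp hp≈hq ¬pq
    with allInRange⊎counterexample (λ s → h p ≤? h s) p q
  ... | inj₂ (s , p≤s , s≤q , hs<hp) =
    let b , p<b , b≤s , hb≡v , rightOfP = firstVisit D s≤N p≤s v<hp (s≤s⁻¹ (subst (h s <_) hp≡1+v (≰⇒> hs<hp)))
        a , _ , a<p , ha≡v , leftOfP    = lastVisit D p≤N z≤n (subst (_≤ v) (sym (start D)) z≤n) v<hp
        b<q = ≤∧≢⇒< (≤-trans b≤s s≤q) λ b≡q → hq≢v (trans (cong (parity ∘ h) (sym b≡q)) (cong parity hb≡v))
    in a , b , sameVertex-bridge h (<⇒≤ a<p) (<⇒≤ p<b) ha≡v hb≡v leftOfP rightOfP , <-trans b<q q<N ,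
       trans (cong parity ha≡v) (parity-pred hp≡1+v) , inj₁ (a<p , p<b , b<q)
    where
    v : ℕ
    v = pred (h p)
    hp≡1+v : h p ≡ suc v
    hp≡1+v = sym (suc-pred (h p) {{>-nonZero 1≤hp}})
    v<hp : v < h p
    v<hp = subst (v <_) (sym hp≡1+v) ≤-refl
    p≤N : p ≤ N
    p≤N = <⇒≤ (<-trans p<q q<N)
    s≤N : s ≤ N
    s≤N = ≤-trans s≤q (<⇒≤ q<N)
    hq≢v : parity (h q) ≢ parity v
    hq≢v eq = p≢p⁻¹ _ (trans (trans hp≈hq eq) (parity-pred hp≡1+v))
  ... | inj₁ allAbove =
    let a , p≤a , a<q , ha≡v , leftOfQ  = lastVisit D (<⇒≤ q<N) (<⇒≤ p<q) (<⇒≤ hp<v) v<hq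
        b , q<b , b≤N , hb≡v , rightOfQ = firstVisit D ≤-refl (<⇒≤ q<N) v<hq (subst (_≤ v) (sym (end D)) z≤n)
        b<N = ≤∧≢⇒< b≤N λ b≡N → <⇒≢ (≤-<-trans z≤n hp<v) (sym (trans (sym hb≡v) (trans (cong h b≡N) (end D))))
        p<a = ≤∧≢⇒< p≤a λ p≡a → <⇒≢ hp<v (trans (cong h p≡a) ha≡v)
    in a , b , sameVertex-bridge h (<⇒≤ a<q) (<⇒≤ q<b) ha≡v hb≡v leftOfQ rightOfQ , b<N ,
       trans (cong parity ha≡v) (trans (parity-pred hq≡1+v) (cong _⁻¹ (sym hp≈hq))) , inj₂ (p<a , a<q , q<b)
    where
    hp≤hq : h p ≤ h q
    hp≤hq = allAbove q (<⇒≤ p<q) ≤-refl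
    hp<hq : h p < h q
    hp<hq = ≤∧≢⇒< hp≤hq λ hp≡hq → ¬pq (hp≡hq , λ s btw →
              let p≤s , s≤q = between-ordered (<⇒≤ p<q) btw in allAbove s p≤s s≤q)
    v : ℕ
    v = pred (h q)
    hq≡1+v : h q ≡ suc v
    hq≡1+v = sym (suc-pred (h q) {{>-nonZero (<-≤-trans (s≤s z≤n) hp<hq)}})
    v<hq : v < h q
    v<hq = subst (v <_) (sym hq≡1+v) ≤-refl
    hp<v : h p < v
    hp<v = ≤∧≢⇒< (s≤s⁻¹ (subst (h p <_) hq≡1+v hp<hq))
                 λ hp≡v → p≢p⁻¹ _ (trans (trans (sym hp≈hq) (cong parity hp≡v)) (parity-pred hq≡1+v))

indicator : Bool → ℕ
indicator b = if b then 1 else 0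

count : (ℕ → Bool) → ℕ → ℕ
count g zero    = 0
count g (suc k) = indicator (g 0) + count (g ∘ suc) k

count-cong : ∀ {g g′} k → (∀ j → j < k → g j ≡ g′ j) → count g k ≡ count g′ k
count-cong zero    g≡g′ = refl
count-cong (suc k) g≡g′ = cong₂ _+_ (cong indicator (g≡g′ 0 z<s)) (count-cong k λ j j<k → g≡g′ (suc j) (s<s j<k))

count-none : ∀ {g} k → (∀ j → j < k → g j ≡ false) → count g k ≡ 0
count-none zero    none = refl
count-none (suc k) none rewrite none 0 z<s = count-none k λ j j<k → none (suc j) (s<s j<k)

count-+ : ∀ g k l → count g (k + l) ≡ count g k + count (λ j → g (k + j)) l
count-+ g zero    l = refl
count-+ g (suc k) l = trans (cong (indicator (g 0) +_) (count-+ (g ∘ suc) k l)) (sym (+-assoc (indicator (g 0)) _ _))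

count-suc : ∀ g k → count g (suc k) ≡ count g k + indicator (g k)
count-suc g zero    = +-identityʳ _
count-suc g (suc k) = trans (cong (indicator (g 0) +_) (count-suc (g ∘ suc) k)) (sym (+-assoc (indicator (g 0)) _ _))

count-double : ∀ g n → count g (double n) ≡ count (g ∘ double) n + count (g ∘ suc ∘ double) n
count-double g zero    = refl
count-double g (suc n) =
  trans (cong (λ c → indicator (g 0) + (indicator (g 1) + c)) (count-double (g ∘ suc ∘ suc) n))
        (interchange (indicator (g 0)) (indicator (g 1)) _ _)
  where
  interchange : ∀ a b x y → a + (b + (x + y)) ≡ a + x + (b + y)
  interchange = solve-∀

-- The contour walk of a forest

glue : ℕ → (ℕ → ℕ) → (ℕ → ℕ) → ℕ → ℕ
glue zero    f g zero    = suc (f 0)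
glue zero    f g (suc p) = g p
glue (suc m) f g zero    = suc (f 0)
glue (suc m) f g (suc p) = glue m (f ∘ suc) g p

glue-left : ∀ m f g {p} → p ≤ m → glue m f g p ≡ suc (f p)
glue-left zero    f g z≤n       = refl
glue-left (suc m) f g z≤n       = refl
glue-left (suc m) f g (s≤s p≤m) = glue-left m (f ∘ suc) g p≤m

glue-right : ∀ m f g q → glue m f g (suc (m + q)) ≡ g q
glue-right zero    f g q = refl
glue-right (suc m) f g q = glue-right m (f ∘ suc) g q

contour : List Tree → ℕ → ℕ
contour []             _       = 0
contour (node cs ∷ ts) zero    = 0
contour (node cs ∷ ts) (suc p) = glue (double (sizes cs)) (contour cs) (contour ts) p

contour-start : ∀ f → contour f 0 ≡ 0
contour-start []             = refl
contour-start (node cs ∷ ts) = refl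

module _ (cs ts : List Tree) where

  contour-inside : ∀ {p} → p ≤ double (sizes cs) → contour (node cs ∷ ts) (suc p) ≡ suc (contour cs p)
  contour-inside = glue-left (double (sizes cs)) (contour cs) (contour ts)

  contour-after : ∀ q → contour (node cs ∷ ts) (suc (suc (double (sizes cs) + q))) ≡ contour ts q
  contour-after = glue-right (double (sizes cs)) (contour cs) (contour ts)

  contour-return : contour (node cs ∷ ts) (suc (suc (double (sizes cs)))) ≡ 0
  contour-return = trans (cong (contour (node cs ∷ ts) ∘ suc ∘ suc) (sym (+-identityʳ _)))
                         (trans (contour-after 0) (contour-start ts))

  length-∷ : double (sizes (node cs ∷ ts)) ≡ suc (suc (double (sizes cs) + double (sizes ts)))
  length-∷ = double-+ (suc (sizes cs)) (sizes ts)

  inside-≤ : ∀ {p} → p ≤ suc (double (sizes cs)) → p ≤ double (sizes (node cs ∷ ts))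
  inside-≤ {p} p≤ = subst (p ≤_) (sym length-∷) (≤-trans p≤ (s≤s (≤-trans (m≤m+n _ _) (n≤1+n _))))

  after-≤ : ∀ {q} → q ≤ double (sizes ts) → suc (suc (double (sizes cs) + q)) ≤ double (sizes (node cs ∷ ts))
  after-≤ {q} q≤ = subst (suc (suc (double (sizes cs) + q)) ≤_) (sym length-∷)
                         (s≤s (s≤s (+-monoʳ-≤ (double (sizes cs)) q≤)))

  after-≤⁻¹ : ∀ {q} → suc (suc (double (sizes cs) + q)) ≤ double (sizes (node cs ∷ ts)) → q ≤ double (sizes ts)
  after-≤⁻¹ {q} le =
    +-cancelˡ-≤ (double (sizes cs)) _ _ (s≤s⁻¹ (s≤s⁻¹ (subst (suc (suc (double (sizes cs) + q)) ≤_) length-∷ le)))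

  return-≤ : suc (suc (double (sizes cs))) ≤ double (sizes (node cs ∷ ts))
  return-≤ = subst (suc (suc (double (sizes cs))) ≤_) (sym length-∷) (s≤s (s≤s (m≤m+n _ _)))

data ContourPos (m : ℕ) : ℕ → Set where
  root   : ContourPos m 0
  inside : ∀ p → p ≤ m → ContourPos m (suc p)
  after  : ∀ q → ContourPos m (suc (suc (m + q)))

contourPos : ∀ m p → ContourPos m p
contourPos m zero    = root
contourPos m (suc p) with p ≤? m
... | yes p≤m = inside p p≤m
... | no p≰m  = subst (ContourPos m ∘ suc) (m+[n∸m]≡n (≰⇒> p≰m)) (after (p ∸ suc m))

step-transport : ∀ h g {p q} k → h p ≡ k + g q → h (suc p) ≡ k + g (suc q) → Step g q → Step h p
step-transport h g {q = q} k hp hp′ (inj₁ up) =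
  inj₁ (trans hp′ (trans (cong (k +_) up) (trans (+-suc k (g q)) (cong suc (sym hp)))))
step-transport h g {q = q} k hp hp′ (inj₂ down) =
  inj₂ (trans hp (trans (cong (k +_) down) (trans (+-suc k (g (suc q))) (cong suc (sym hp′)))))

contour-isDyck : ∀ f → IsDyck (contour f) (double (sizes f))
contour-isDyck []             = record { start = refl ; end = refl ; step = λ _ () }
contour-isDyck (node cs ∷ ts) = record { start = refl ; end = end′ ; step = step′ }
  where
  m : ℕ
  m = double (sizes cs)
  end′ : contour (node cs ∷ ts) (double (sizes (node cs ∷ ts))) ≡ 0
  end′ = trans (cong (contour (node cs ∷ ts)) (length-∷ cs ts)) (trans (contour-after cs ts _) (end (contour-isDyck ts)))
  step′ : ∀ p → p < double (sizes (node cs ∷ ts)) → Step (contour (node cs ∷ ts)) p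
  step′ p p<len with contourPos m p
  ... | root = inj₁ (trans (contour-inside cs ts z≤n) (cong suc (contour-start cs)))
  ... | inside p′ p′≤m with m≤n⇒m<n∨m≡n p′≤m
  ...   | inj₁ p′<m =
    step-transport (contour (node cs ∷ ts)) (contour cs) 1 (contour-inside cs ts p′≤m) (contour-inside cs ts p′<m)
                   (step (contour-isDyck cs) p′ p′<m)
  ...   | inj₂ refl =
    inj₂ (trans (contour-inside cs ts p′≤m) (cong suc (trans (end (contour-isDyck cs)) (sym (contour-return cs ts)))))
  step′ p p<len | after q =
    step-transport (contour (node cs ∷ ts)) (contour ts) 0 (contour-after cs ts q)
      (trans (cong (contour (node cs ∷ ts) ∘ suc ∘ suc) (sym (+-suc m q))) (contour-after cs ts (suc q)))
      (step (contour-isDyck ts) q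
            (after-≤⁻¹ cs ts (subst (_≤ double (sizes (node cs ∷ ts))) (cong (suc ∘ suc) (sym (+-suc m q))) p<len)))

first-return : ∀ cs ts cs′ ts′ → double (sizes cs) < double (sizes cs′) →
               contour (node cs ∷ ts) (suc (suc (double (sizes cs)))) ≢
               contour (node cs′ ∷ ts′) (suc (suc (double (sizes cs))))
first-return cs ts cs′ ts′ m<m′ eq = 0≢1+n (trans (sym (contour-return cs ts)) (trans eq (contour-inside cs′ ts′ m<m′)))

contour-injective : ∀ f g → double (sizes f) ≡ double (sizes g) →
                    (∀ p → p ≤ double (sizes f) → contour f p ≡ contour g p) → f ≡ g
contour-injective []             []               _    _     = refl
contour-injective []             (node cs ∷ ts)   len≡ _     = ⊥-elim (0≢1+n (trans len≡ (length-∷ cs ts)))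
contour-injective (node cs ∷ ts) []               len≡ _     = ⊥-elim (0≢1+n (trans (sym len≡) (length-∷ cs ts)))
contour-injective (node cs ∷ ts) (node cs′ ∷ ts′) len≡ agree = cong₂ (λ c t → node c ∷ t) cs≡cs′ ts≡ts′
  where
  m m′ : ℕ
  m  = double (sizes cs)
  m′ = double (sizes cs′)
  m≡m′ : m ≡ m′
  m≡m′ with <-cmp m m′
  ... | tri≈ _ eq _ = eq
  ... | tri< m<m′ _ _ = ⊥-elim (first-return cs ts cs′ ts′ m<m′ (agree _ (return-≤ cs ts)))
  ... | tri> _ _ m′<m = ⊥-elim (first-return cs′ ts′ cs ts m′<m
                          (sym (agree _ (subst (suc (suc m′) ≤_) (sym len≡) (return-≤ cs′ ts′)))))
  cs≡cs′ : cs ≡ cs′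
  cs≡cs′ = contour-injective cs cs′ m≡m′ λ p p≤m →
    suc-injective (trans (sym (contour-inside cs ts p≤m))
                  (trans (agree (suc p) (inside-≤ cs ts (s≤s p≤m)))
                         (contour-inside cs′ ts′ (subst (p ≤_) m≡m′ p≤m))))
  ts≡ts′ : ts ≡ ts′
  ts≡ts′ = contour-injective ts ts′ rest≡ λ q q≤ →
    trans (sym (contour-after cs ts q))
    (trans (agree _ (after-≤ cs ts q≤))
    (trans (cong (λ x → contour (node cs′ ∷ ts′) (suc (suc (x + q)))) m≡m′) (contour-after cs′ ts′ q)))
    where
    rest≡ : double (sizes ts) ≡ double (sizes ts′)
    rest≡ = +-cancelˡ-≡ m _ _ (suc-injective (suc-injective
              (trans (sym (length-∷ cs ts))
                     (trans len≡ (trans (length-∷ cs′ ts′) (cong (λ x → suc (suc (x + _))) (sym m≡m′)))))))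

-- Every Dyck path is the contour of a forest

ContourOf : (ℕ → ℕ) → ℕ → List Tree → Set
ContourOf h N f = double (sizes f) ≡ N × (∀ p → p ≤ N → contour f p ≡ h p)

pred-step : ∀ {x y} → 0 < x → 0 < y → (y ≡ suc x ⊎ x ≡ suc y) → (pred y ≡ suc (pred x) ⊎ pred x ≡ suc (pred y))
pred-step {suc x} {suc y} _ _ (inj₁ up)   = inj₁ (suc-injective up)
pred-step {suc x} {suc y} _ _ (inj₂ down) = inj₂ (suc-injective down)

module _ {h : ℕ → ℕ} {N : ℕ} (D : IsDyck h N) where

  dyck-rises : 0 < N → h 1 ≡ 1
  dyck-rises 0<N with step D 0 0<N
  ... | inj₁ up   = trans up (cong suc (start D))
  ... | inj₂ down = ⊥-elim (0≢1+n (trans (sym (start D)) down))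

  firstReturn : 0 < N → ∃ λ r → suc (suc r) ≤ N × h (suc (suc r)) ≡ 0 × (∀ p → 0 < p → p < suc (suc r) → 0 < h p)
  firstReturn 0<N with leastWitness (λ p → (0 <? p) ×-dec (h p ≟ 0)) {N} (0<N , end D)
  ... | suc zero    , _     , (_ , h1≡0)   , _     = ⊥-elim (0≢1+n (trans (sym h1≡0) (dyck-rises 0<N)))
  ... | suc (suc r) , r+2≤N , (_ , hr+2≡0) , below =
    r , r+2≤N , hr+2≡0 , λ p 0<p p<r+2 → n≢0⇒n>0 λ hp≡0 → below p p<r+2 (0<p , hp≡0)

  dyck-drop : ∀ {r} → r ≤ N → h r ≡ 0 → IsDyck (λ p → h (r + p)) (N ∸ r)
  dyck-drop {r} r≤N hr≡0 = record
    { start = trans (cong h (+-identityʳ r)) hr≡0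
    ; end   = trans (cong h (m+[n∸m]≡n r≤N)) (end D)
    ; step  = λ p p<N∸r → step-transport (λ p → h (r + p)) h 0 refl (cong h (+-suc r p))
                            (step D (r + p) (subst (r + p <_) (m+[n∸m]≡n r≤N) (+-monoʳ-< r p<N∸r)))
    }

  dyck-lower : ∀ {r} → suc (suc r) ≤ N → h (suc (suc r)) ≡ 0 → (∀ p → 0 < p → p < suc (suc r) → 0 < h p) →
               IsDyck (λ p → pred (h (suc p))) r
  dyck-lower {r} r+2≤N hr+2≡0 positive = record
    { start = cong pred (dyck-rises (≤-trans (s≤s z≤n) r+2≤N))
    ; end   = end′
    ; step  = λ p p<r → pred-step (positive (suc p) z<s (s≤s (m<n⇒m<1+n p<r))) (positive (suc (suc p)) z<s (s≤s (s≤s p<r)))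
                                  (step D (suc p) (≤-trans (s≤s (s≤s (<⇒≤ p<r))) r+2≤N))
    }
    where
    end′ : pred (h (suc r)) ≡ 0
    end′ with step D (suc r) r+2≤N
    ... | inj₁ up   = ⊥-elim (0≢1+n (trans (sym hr+2≡0) up))
    ... | inj₂ down = trans (cong pred down) hr+2≡0

-- Up to its first return to 0 the path, lowered by one, is the contour of the children of the
-- first tree; the rest is the contour of the remaining trees.  K bounds the length.
dyck⇒contour : ∀ {h N} → IsDyck h N → ∃ (ContourOf h N)
dyck⇒contour {N = N} = decode N ≤-refl
  where
  decode : ∀ K {h N} → N ≤ K → IsDyck h N → ∃ (ContourOf h N)
  decode K {N = zero} _ D = [] , refl , λ { zero z≤n → sym (start D) }
  decode (suc K) {h} {suc N} (s≤s N≤K) D with firstReturn D z<s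
  ... | r , r+2≤N , hr+2≡0 , positive = node cs ∷ ts , length≡ , heights
    where
    inner : ∃ (ContourOf (λ p → pred (h (suc p))) r)
    inner = decode K (≤-trans (≤-trans (n≤1+n r) (s≤s⁻¹ r+2≤N)) N≤K) (dyck-lower D r+2≤N hr+2≡0 positive)
    rest : ∃ (ContourOf (λ p → h (suc (suc r) + p)) (suc N ∸ suc (suc r)))
    rest = decode K (≤-trans (m∸n≤m N (suc r)) N≤K) (dyck-drop D r+2≤N hr+2≡0)
    cs ts : List Tree
    cs = proj₁ inner
    ts = proj₁ rest
    cs-length : double (sizes cs) ≡ r
    cs-length = proj₁ (proj₂ inner)
    length≡ : double (sizes (node cs ∷ ts)) ≡ suc N
    length≡ = trans (length-∷ cs ts) (trans (cong₂ (λ a b → suc (suc (a + b))) cs-length (proj₁ (proj₂ rest)))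
                                            (m+[n∸m]≡n r+2≤N))
    heights : ∀ p → p ≤ suc N → contour (node cs ∷ ts) p ≡ h p
    heights p p≤ with contourPos r p
    ... | root = sym (start D)
    ... | inside p′ p′≤r =
      trans (contour-inside cs ts (subst (p′ ≤_) (sym cs-length) p′≤r))
            (trans (cong suc (proj₂ (proj₂ inner) p′ p′≤r))
                   (suc-pred (h (suc p′)) {{>-nonZero (positive (suc p′) z<s (s≤s (s≤s p′≤r)))}}))
    ... | after q =
      trans (cong (λ x → contour (node cs ∷ ts) (suc (suc (x + q)))) (sym cs-length))
            (trans (contour-after cs ts q)
                   (proj₂ (proj₂ rest) q (m+n≤o⇒m≤o∸n q (subst (_≤ suc N) (+-comm (suc (suc r)) q) p≤))))

visits : List Tree → ℕ → ℕ
visits f p = count (sameVertexᵇ (contour f) p) (suc (double (sizes f)))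

module _ (cs ts : List Tree) where

  private
    m : ℕ
    m = double (sizes cs)
    h : ℕ → ℕ
    h = contour (node cs ∷ ts)

  count-∷ : ∀ g → count g (suc (double (sizes (node cs ∷ ts)))) ≡
            indicator (g 0) + (count (g ∘ suc) (suc m) + count (λ j → g (suc (suc (m + j)))) (suc (double (sizes ts))))
  count-∷ g = trans (cong (count g ∘ suc) (trans (length-∷ cs ts) (cong suc (sym (+-suc m _)))))
                    (cong (indicator (g 0) +_) (count-+ (g ∘ suc) (suc m) (suc (double (sizes ts)))))

  private
    returnBetween : ∀ {p q} → 0 < h p → Between p (suc (suc m)) q → sameVertexᵇ h p q ≡ false
    returnBetween {p} {q} 0<hp btw =
      dec-false (sameVertex? h p _) (sameVertex-blocked h btw (subst (_< h p) (sym (contour-return cs ts)) 0<hp))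

    distinctHeights : ∀ {p q} → h p ≢ h q → sameVertexᵇ h p q ≡ false
    distinctHeights {p} {q} hp≢hq = dec-false (sameVertex? h p q) (hp≢hq ∘ proj₁)

  visits-inside : ∀ {p} → p ≤ m → visits (node cs ∷ ts) (suc p) ≡ visits cs p
  visits-inside {p} p≤m = begin
    visits (node cs ∷ ts) (suc p)                  ≡⟨ count-∷ g ⟩
    indicator (g 0) + (count (g ∘ suc) (suc m) + rest) ≡⟨ cong₂ (λ a b → a + (b + rest)) g0≡0 same ⟩
    visits cs p + rest                             ≡⟨ cong (visits cs p +_) (count-none _ none) ⟩
    visits cs p + 0                                ≡⟨ +-identityʳ _ ⟩
    visits cs p                                    ∎
    where
    open ≡-Reasoning
    g : ℕ → Bool
    g = sameVertexᵇ h (suc p)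
    rest : ℕ
    rest = count (λ j → g (suc (suc (m + j)))) (suc (double (sizes ts)))
    hp≡ : h (suc p) ≡ suc (contour cs p)
    hp≡ = contour-inside cs ts p≤m
    g0≡0 : indicator (g 0) ≡ 0
    g0≡0 = cong indicator (distinctHeights {suc p} {0} λ eq → 0≢1+n (trans (sym eq) hp≡))
    same : count (g ∘ suc) (suc m) ≡ visits cs p
    same = count-cong (suc m) λ j j<1+m →
      sameVertexᵇ-shift h (contour cs) (λ s s≤m → contour-inside cs ts s≤m) p≤m (s≤s⁻¹ j<1+m)
    none : ∀ j → j < suc (double (sizes ts)) → g (suc (suc (m + j))) ≡ false
    none j _ = returnBetween (subst (0 <_) (sym hp≡) z<s) (inj₁ (s≤s (m≤n⇒m≤1+n p≤m) , s≤s (s≤s (m≤m+n m j))))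

  visits-after : ∀ {q} → q ≤ double (sizes ts) → 0 < contour ts q →
                 visits (node cs ∷ ts) (suc (suc (m + q))) ≡ visits ts q
  visits-after {q} q≤ 0<hq = begin
    visits (node cs ∷ ts) P                        ≡⟨ count-∷ g ⟩
    indicator (g 0) + (count (g ∘ suc) (suc m) + rest) ≡⟨ cong₂ (λ a b → a + (b + rest)) g0≡0 (count-none _ none) ⟩
    rest                                           ≡⟨ same ⟩
    visits ts q                                    ∎
    where
    open ≡-Reasoning
    P : ℕ
    P = suc (suc (m + q))
    g : ℕ → Bool
    g = sameVertexᵇ h P
    rest : ℕ
    rest = count (λ j → g (suc (suc (m + j)))) (suc (double (sizes ts)))
    hP≡ : h P ≡ contour ts q
    hP≡ = contour-after cs ts q
    g0≡0 : indicator (g 0) ≡ 0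
    g0≡0 = cong indicator (distinctHeights {P} {0} λ eq → <⇒≢ 0<hq (sym (trans (sym hP≡) eq)))
    none : ∀ j → j < suc m → g (suc j) ≡ false
    none j j<1+m = returnBetween (subst (0 <_) (sym hP≡) 0<hq) (inj₂ (m≤n⇒m≤1+n j<1+m , s≤s (s≤s (m≤m+n m q))))
    same : rest ≡ visits ts q
    same = count-cong (suc (double (sizes ts))) λ j j≤ →
      sameVertexᵇ-shift h (contour ts) (λ s _ → contour-after cs ts s) q≤ (s≤s⁻¹ j≤)

rootVisits : ∀ f → count (λ q → does (contour f q ≟ 0)) (suc (double (sizes f))) ≡ suc (length f)
rootVisits []             = refl
rootVisits (node cs ∷ ts) =
  trans (count-∷ cs ts (λ q → does (contour (node cs ∷ ts) q ≟ 0)))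
        (cong suc (cong₂ _+_ (count-none (suc (double (sizes cs))) inside-positive) (trans rest (rootVisits ts))))
  where
  inside-positive : ∀ j → j < suc (double (sizes cs)) → does (contour (node cs ∷ ts) (suc j) ≟ 0) ≡ false
  inside-positive j j<1+m = dec-false (contour (node cs ∷ ts) (suc j) ≟ 0) λ eq →
    0≢1+n (trans (sym eq) (contour-inside cs ts (s≤s⁻¹ j<1+m)))
  rest : count (λ j → does (contour (node cs ∷ ts) (suc (suc (double (sizes cs) + j))) ≟ 0)) (suc (double (sizes ts)))
       ≡ count (λ q → does (contour ts q ≟ 0)) (suc (double (sizes ts)))
  rest = count-cong (suc (double (sizes ts))) λ j _ → cong (λ x → does (x ≟ 0)) (contour-after cs ts j)

visits-root : ∀ f {p} → contour f p ≡ 0 → visits f p ≡ suc (length f)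
visits-root f hp≡0 = trans (count-cong (suc (double (sizes f))) λ q _ → sameVertexᵇ-ground (contour f) {q = q} hp≡0) (rootVisits f)

NonRootVisitsOK : ℕ → List Tree → Set
NonRootVisitsOK d f = ∀ p → p ≤ double (sizes f) → 0 < contour f p → Cong1 d (visits f p)

allNonRootOK⇒nonRootVisitsOK : ∀ {d} f → AllNonRootOK d f → NonRootVisitsOK d f
allNonRootOK⇒nonRootVisitsOK (node cs ∷ ts) (node deg oks ∷ okts) p p≤ 0<hp with contourPos (double (sizes cs)) p
... | inside p′ p′≤m with contour cs p′ ≟ 0
...   | yes hp′≡0 = subst (Cong1 _) (sym (trans (visits-inside cs ts p′≤m) (visits-root cs hp′≡0))) deg
...   | no hp′≢0  =
  subst (Cong1 _) (sym (visits-inside cs ts p′≤m)) (allNonRootOK⇒nonRootVisitsOK cs oks p′ p′≤m (n≢0⇒n>0 hp′≢0))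
allNonRootOK⇒nonRootVisitsOK (node cs ∷ ts) (node deg oks ∷ okts) p p≤ 0<hp | after q =
  subst (Cong1 _) (sym (visits-after cs ts q≤ 0<hq)) (allNonRootOK⇒nonRootVisitsOK ts okts q q≤ 0<hq)
  where
  q≤ : q ≤ double (sizes ts)
  q≤ = after-≤⁻¹ cs ts p≤
  0<hq : 0 < contour ts q
  0<hq = subst (0 <_) (contour-after cs ts q) 0<hp

nonRootVisitsOK⇒allNonRootOK : ∀ {d} f → NonRootVisitsOK d f → AllNonRootOK d f
nonRootVisitsOK⇒allNonRootOK []             ok = []
nonRootVisitsOK⇒allNonRootOK (node cs ∷ ts) ok =
  node deg (nonRootVisitsOK⇒allNonRootOK cs okcs) ∷ nonRootVisitsOK⇒allNonRootOK ts okts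
  where
  deg : Cong1 _ (suc (length cs))
  deg = subst (Cong1 _) (trans (visits-inside cs ts z≤n) (visits-root cs (contour-start cs)))
              (ok 1 (inside-≤ cs ts (s≤s z≤n)) (subst (0 <_) (sym (contour-inside cs ts z≤n)) z<s))
  okcs : NonRootVisitsOK _ cs
  okcs p p≤ _ = subst (Cong1 _) (visits-inside cs ts p≤)
                      (ok (suc p) (inside-≤ cs ts (s≤s p≤)) (subst (0 <_) (sym (contour-inside cs ts p≤)) z<s))
  okts : NonRootVisitsOK _ ts
  okts q q≤ 0<hq = subst (Cong1 _) (visits-after cs ts q≤ 0<hq)
                         (ok _ (after-≤ cs ts q≤) (subst (0 <_) (sym (contour-after cs ts q)) 0<hq))

matrix : (ℕ → ℕ → Bool) → (n : ℕ) → Matrix n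
matrix g n = tabulate λ i → tabulate λ j → g (toℕ i) (toℕ j)

lookup-matrix : ∀ g {n} (i j : Fin n) → lookup (lookup (matrix g n) i) j ≡ g (toℕ i) (toℕ j)
lookup-matrix g i j = trans (cong (λ row → lookup row j) (lookup∘tabulate _ i)) (lookup∘tabulate _ j)

count-tabulate : ∀ n (f : ℕ → Bool) → countTrue (tabulate {n = n} (f ∘ toℕ)) ≡ count f n
count-tabulate zero    f = refl
count-tabulate (suc n) f with f 0
... | true  = cong suc (count-tabulate n (f ∘ suc))
... | false = count-tabulate n (f ∘ suc)

blockSize-matrix : ∀ g {n} (i : Fin n) → blockSize (matrix g n) i ≡ count (g (toℕ i)) n
blockSize-matrix g {n} i = trans (cong countTrue (lookup∘tabulate _ i)) (count-tabulate n (g (toℕ i)))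

matrix-ext : ∀ {n} (A B : Matrix n) → (∀ i j → lookup (lookup A i) j ≡ lookup (lookup B i) j) → A ≡ B
matrix-ext A B A≗B = trans (sym (tabulate∘lookup A)) (trans (tabulate-cong row≡) (tabulate∘lookup B))
  where
  row≡ : ∀ i → lookup A i ≡ lookup B i
  row≡ i = trans (sym (tabulate∘lookup (lookup A i))) (trans (tabulate-cong (A≗B i)) (tabulate∘lookup (lookup B i)))

-- Entries read with natural-number indices, false outside the matrix.
vecAt : ∀ {m} → Vec Bool m → ℕ → Bool
vecAt []       _       = false
vecAt (b ∷ bs) zero    = b
vecAt (b ∷ bs) (suc k) = vecAt bs k

rowAt : ∀ {n m} → Vec (Vec Bool n) m → ℕ → Vec Bool n
rowAt {n} []       _       = replicate n false
rowAt     (r ∷ rs) zero    = r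
rowAt     (r ∷ rs) (suc k) = rowAt rs k

entry : ∀ {n} → Matrix n → ℕ → ℕ → Bool
entry π i j = vecAt (rowAt π i) j

entry-lookup : ∀ {n} (π : Matrix n) (i j : Fin n) → entry π (toℕ i) (toℕ j) ≡ lookup (lookup π i) j
entry-lookup π i j = trans (cong (λ row → vecAt row (toℕ j)) (rowAt-lookup π i)) (vecAt-lookup (lookup π i) j)
  where
  vecAt-lookup : ∀ {m} (v : Vec Bool m) (i : Fin m) → vecAt v (toℕ i) ≡ lookup v i
  vecAt-lookup (b ∷ bs) fzero    = refl
  vecAt-lookup (b ∷ bs) (fsuc i) = vecAt-lookup bs i
  rowAt-lookup : ∀ {n m} (v : Vec (Vec Bool n) m) (i : Fin m) → rowAt v (toℕ i) ≡ lookup v i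
  rowAt-lookup (r ∷ rs) fzero    = refl
  rowAt-lookup (r ∷ rs) (fsuc i) = rowAt-lookup rs i

entry-bounded : ∀ {n} (π : Matrix n) i j → entry π i j ≡ true → i < n × j < n
entry-bounded π i j e = rowAt-bounded π i j e , vecAt-bounded (rowAt π i) j e
  where
  vecAt-bounded : ∀ {m} (v : Vec Bool m) j → vecAt v j ≡ true → j < m
  vecAt-bounded (b ∷ bs) zero    _ = z<s
  vecAt-bounded (b ∷ bs) (suc j) e = s<s (vecAt-bounded bs j e)
  vecAt-replicate : ∀ n j → vecAt (replicate n false) j ≡ false
  vecAt-replicate zero    j       = refl
  vecAt-replicate (suc n) zero    = refl
  vecAt-replicate (suc n) (suc j) = vecAt-replicate n j
  rowAt-bounded : ∀ {n m} (v : Vec (Vec Bool n) m) i j → vecAt (rowAt v i) j ≡ true → i < m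
  rowAt-bounded {n} []       i       j e with () ← trans (sym e) (vecAt-replicate n j)
  rowAt-bounded     (r ∷ rs) zero    j e = z<s
  rowAt-bounded     (r ∷ rs) (suc i) j e = s<s (rowAt-bounded rs i j e)

entry-fromℕ< : ∀ {n} (π : Matrix n) {i j} (i<n : i < n) (j<n : j < n) →
               entry π i j ≡ lookup (lookup π (fromℕ< i<n)) (fromℕ< j<n)
entry-fromℕ< π i<n j<n =
  trans (cong₂ (entry π) (sym (toℕ-fromℕ< i<n)) (sym (toℕ-fromℕ< j<n))) (entry-lookup π (fromℕ< i<n) (fromℕ< j<n))

does⇒ : ∀ {A : Set} (a? : Dec A) → does a? ≡ true → A
does⇒ (yes a) _ = a

bool-ext : ∀ {a b : Bool} → (a ≡ true → b ≡ true) → (b ≡ true → a ≡ true) → a ≡ b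
bool-ext {true}  {true}  _ _ = refl
bool-ext {true}  {false} a⇒b _ = sym (a⇒b refl)
bool-ext {false} {true}  _ b⇒a = b⇒a refl
bool-ext {false} {false} _ _ = refl

kreweras-unique : ∀ {n} {π σ σ′ : Matrix n} → IsKreweras π σ → IsKreweras π σ′ → σ ≡ σ′
kreweras-unique {σ = σ} {σ′} (P , nc , coarsest) (P′ , nc′ , coarsest′) =
  matrix-ext σ σ′ λ i j → bool-ext (coarsest′ σ P nc i j) (coarsest σ′ P′ nc′ i j)

-- The partitions read off a Dyck path

vertexMatrix : (h f : ℕ → ℕ) (n : ℕ) → Matrix n
vertexMatrix h f n = matrix (λ i j → sameVertexᵇ h (f i) (f j)) n

module _ (h f : ℕ → ℕ) {n : ℕ} where

  lookup-vertexMatrix : ∀ (i j : Fin n) → lookup (lookup (vertexMatrix h f n) i) j ≡ sameVertexᵇ h (f (toℕ i)) (f (toℕ j))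
  lookup-vertexMatrix = lookup-matrix (λ i j → sameVertexᵇ h (f i) (f j))

  blockSize-vertexMatrix : ∀ (i : Fin n) → blockSize (vertexMatrix h f n) i ≡ count (sameVertexᵇ h (f (toℕ i)) ∘ f) n
  blockSize-vertexMatrix = blockSize-matrix (λ i j → sameVertexᵇ h (f i) (f j))

  vertexMatrix-sound : ∀ {i j : Fin n} → Rel (vertexMatrix h f n) i j → SameVertex h (f (toℕ i)) (f (toℕ j))
  vertexMatrix-sound {i} {j} r = does⇒ (sameVertex? h _ _) (trans (sym (lookup-vertexMatrix i j)) r)

  vertexMatrix-complete : ∀ {i j : Fin n} → SameVertex h (f (toℕ i)) (f (toℕ j)) → Rel (vertexMatrix h f n) i j
  vertexMatrix-complete {i} {j} s = trans (lookup-vertexMatrix i j) (dec-true (sameVertex? h _ _) s)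

  vertexMatrix-isPartition : IsPartition (vertexMatrix h f n)
  vertexMatrix-isPartition =
    (λ i → vertexMatrix-complete (sameVertex-refl h _)) ,
    (λ i j r → vertexMatrix-complete (sameVertex-sym h (vertexMatrix-sound r))) ,
    (λ i j k r s → vertexMatrix-complete (sameVertex-trans h (vertexMatrix-sound r) (vertexMatrix-sound s)))

position : ∀ {n} → Point n → ℕ
position (i , false) = double (toℕ i)
position (i , true)  = suc (double (toℕ i))

pos≡position : ∀ {n} (a : Point n) → pos a ≡ position a
pos≡position (i , false) = 2*≡double (toℕ i)
pos≡position (i , true)  = cong suc (2*≡double (toℕ i))

position<double : ∀ {n} (a : Point n) → position a < double n
position<double (i , false) = double-mono-< (toℕ<n i)
position<double (i , true)  = double-mono-≤ (toℕ<n i)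

evenPoint : ∀ {n a} → a < double n → parity a ≡ 0ℙ → ∃ λ (u : Fin n) → position (u , false) ≡ a
evenPoint {a = a} a<2n a-even with even⇒double {a} a-even
... | u , refl = fromℕ< (double-cancel-< a<2n) , cong double (toℕ-fromℕ< _)

module FromDyck {h : ℕ → ℕ} {n : ℕ} (D : IsDyck h (double n)) where

  π σ : Matrix n
  π = vertexMatrix h double n
  σ = vertexMatrix h (suc ∘ double) n

  private
    position≤ : ∀ (a : Point n) → position a ≤ double n
    position≤ a = <⇒≤ (position<double a)

    toPos : ∀ {a b : Point n} → position a < position b → pos a < pos b
    toPos {a} {b} = subst₂ _<_ (sym (pos≡position a)) (sym (pos≡position b))

    fromPos : ∀ {a b : Point n} → pos a < pos b → position a < position b
    fromPos {a} {b} = subst₂ _<_ (pos≡position a) (pos≡position b)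

    height-parity-position : ∀ (a : Point n) → parity (h (position a)) ≡ parity (position a)
    height-parity-position a = height-parity D (position a) (position≤ a)

  noMixedVertex : ∀ {x y} → x < n → y < n → ¬ SameVertex h (double x) (suc (double y))
  noMixedVertex {x} {y} x<n y<n s with () ← trans (sym (parity-double x))
    (trans (sameVertex-parity D (<⇒≤ (double-mono-< x<n)) (<⇒≤ (double-mono-≤ y<n)) s) (parity-suc-double y))

  comb⇒sameVertex : ∀ a b → Comb π σ a b → SameVertex h (position a) (position b)
  comb⇒sameVertex (i , false) (j , false) r = vertexMatrix-sound h double r
  comb⇒sameVertex (i , true)  (j , true)  r = vertexMatrix-sound h (suc ∘ double) r

  sameVertex⇒comb : ∀ a b → SameVertex h (position a) (position b) → Comb π σ a b
  sameVertex⇒comb (i , false) (j , false) s = vertexMatrix-complete h double s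
  sameVertex⇒comb (i , true)  (j , true)  s = vertexMatrix-complete h (suc ∘ double) s
  sameVertex⇒comb (i , false) (j , true)  s = noMixedVertex (toℕ<n i) (toℕ<n j) s
  sameVertex⇒comb (i , true)  (j , false) s = noMixedVertex (toℕ<n j) (toℕ<n i) (sameVertex-sym h s)

  comb-noncrossing : NoncrossingOn pos (Comb π σ)
  comb-noncrossing a b c e a<b b<c c<e ac be =
    sameVertex⇒comb a b (sameVertex-noncrossing h (<⇒≤ (fromPos {a} {b} a<b)) (<⇒≤ (fromPos {b} {c} b<c))
                                                  (<⇒≤ (fromPos {c} {e} c<e))
                                                  (comb⇒sameVertex a c ac) (comb⇒sameVertex b e be))

  π-noncrossing : Noncrossing π
  π-noncrossing a b c e a<b b<c c<e =
    comb-noncrossing (a , false) (b , false) (c , false) (e , false)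
                     (toPos {a , false} {b , false} (double-mono-< a<b))
                     (toPos {b , false} {c , false} (double-mono-< b<c))
                     (toPos {c , false} {e , false} (double-mono-< c<e))

  private
    oddHeight : ∀ (i : Fin n) → parity (h (suc (double (toℕ i)))) ≡ 1ℙ
    oddHeight i = trans (height-parity-position (i , true)) (parity-suc-double (toℕ i))

  -- Two odd positions joined by σ′ but at different vertices are separated by a pair of even
  -- positions at one vertex, i.e. by a block of π crossing σ′.
  σ-coarsest-ordered : ∀ σ′ → NoncrossingOn pos (Comb π σ′) → ∀ i j → toℕ i < toℕ j → Rel σ′ i j →
                       SameVertex h (suc (double (toℕ i))) (suc (double (toℕ j)))
  σ-coarsest-ordered σ′ nc′ i j i<j r with sameVertex? h (suc (double (toℕ i))) (suc (double (toℕ j)))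
  ... | yes s = s
  ... | no ¬s with separatingVisits D (s≤s (double-mono-< i<j)) (position<double (j , true)) 0<hp
                                      (trans (oddHeight i) (sym (oddHeight j))) ¬s
    where
    0<hp : 0 < h (suc (double (toℕ i)))
    0<hp = n≢0⇒n>0 λ hp≡0 → case trans (sym (cong parity hp≡0)) (oddHeight i) of λ ()
  ...   | a , b , ab , b<2n , pa , crossing = ⊥-elim (separated crossing)
    where
    a<2n : a < double n
    a<2n = [ (λ (a<p , _) → <-trans a<p (position<double (i , true))) ,
             (λ (_ , a<q , _) → <-trans a<q (position<double (j , true))) ]′ crossing
    a-even : parity a ≡ 0ℙ
    a-even = trans (sym (height-parity D a (<⇒≤ a<2n))) (trans pa (cong _⁻¹ (oddHeight i)))
    b-even : parity b ≡ 0ℙ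
    b-even = trans (sym (sameVertex-parity D (<⇒≤ a<2n) (<⇒≤ b<2n) ab)) a-even
    u : ∃ λ (u : Fin n) → position (u , false) ≡ a
    u = evenPoint a<2n a-even
    w : ∃ λ (w : Fin n) → position (w , false) ≡ b
    w = evenPoint b<2n b-even
    uw : Rel π (proj₁ u) (proj₁ w)
    uw = vertexMatrix-complete h double (subst₂ (SameVertex h) (sym (proj₂ u)) (sym (proj₂ w)) ab)
    separated : Crossing a b (suc (double (toℕ i))) (suc (double (toℕ j))) → ⊥
    separated (inj₁ (a<p , p<b , b<q)) =
      nc′ (proj₁ u , false) (i , true) (proj₁ w , false) (j , true)
          (toPos {proj₁ u , false} {i , true} (subst (_< _) (sym (proj₂ u)) a<p))
          (toPos {i , true} {proj₁ w , false} (subst (_ <_) (sym (proj₂ w)) p<b))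
          (toPos {proj₁ w , false} {j , true} (subst (_< _) (sym (proj₂ w)) b<q)) uw r
    separated (inj₂ (p<a , a<q , q<b)) =
      nc′ (i , true) (proj₁ u , false) (j , true) (proj₁ w , false)
          (toPos {i , true} {proj₁ u , false} (subst (_ <_) (sym (proj₂ u)) p<a))
          (toPos {proj₁ u , false} {j , true} (subst (_< _) (sym (proj₂ u)) a<q))
          (toPos {j , true} {proj₁ w , false} (subst (_ <_) (sym (proj₂ w)) q<b)) r uw

  σ-coarsest : ∀ σ′ → IsPartition σ′ → NoncrossingOn pos (Comb π σ′) → Refines σ′ σ
  σ-coarsest σ′ (_ , sym′ , _) nc′ i j r with <-cmp (toℕ i) (toℕ j)
  ... | tri< i<j _ _ = vertexMatrix-complete h (suc ∘ double) (σ-coarsest-ordered σ′ nc′ i j i<j r)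
  ... | tri≈ _ i≡j _ =
    vertexMatrix-complete h (suc ∘ double) (subst (λ x → SameVertex h _ (suc (double x))) i≡j (sameVertex-refl h _))
  ... | tri> _ _ j<i =
    vertexMatrix-complete h (suc ∘ double) (sameVertex-sym h (σ-coarsest-ordered σ′ nc′ j i j<i (sym′ i j r)))

  isKreweras : IsKreweras π σ
  isKreweras = vertexMatrix-isPartition h (suc ∘ double) , comb-noncrossing , σ-coarsest

  visitCount : ℕ → ℕ
  visitCount p = count (sameVertexᵇ h p) (double n)

  blockSize-π : ∀ i → blockSize π i ≡ visitCount (double (toℕ i))
  blockSize-π i = begin
    blockSize π i  ≡⟨ blockSize-vertexMatrix h double i ⟩
    evens          ≡⟨ +-identityʳ evens ⟨
    evens + 0      ≡⟨ cong (evens +_) (count-none n oddFalse) ⟨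
    evens + odds   ≡⟨ count-double (sameVertexᵇ h p) n ⟨
    visitCount p   ∎
    where
    open ≡-Reasoning
    p evens odds : ℕ
    p = double (toℕ i)
    evens = count (sameVertexᵇ h p ∘ double) n
    odds  = count (sameVertexᵇ h p ∘ suc ∘ double) n
    oddFalse : ∀ j → j < n → sameVertexᵇ h p (suc (double j)) ≡ false
    oddFalse j j<n = dec-false (sameVertex? h _ _) (noMixedVertex (toℕ<n i) j<n)

  blockSize-σ : ∀ i → blockSize σ i ≡ visitCount (suc (double (toℕ i)))
  blockSize-σ i = begin
    blockSize σ i  ≡⟨ blockSize-vertexMatrix h (suc ∘ double) i ⟩
    odds           ≡⟨ cong (_+ odds) (count-none n evenFalse) ⟨
    evens + odds   ≡⟨ count-double (sameVertexᵇ h p) n ⟨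
    visitCount p   ∎
    where
    open ≡-Reasoning
    p evens odds : ℕ
    p = suc (double (toℕ i))
    evens = count (sameVertexᵇ h p ∘ double) n
    odds  = count (sameVertexᵇ h p ∘ suc ∘ double) n
    evenFalse : ∀ j → j < n → sameVertexᵇ h p (double j) ≡ false
    evenFalse j j<n = dec-false (sameVertex? h _ _) (noMixedVertex j<n (toℕ<n i) ∘ sameVertex-sym h)

  VisitCountsOK : ℕ → Set
  VisitCountsOK d = ∀ p → p < double n → Cong1 d (visitCount p)

  blocksOK⇒visitCountsOK : ∀ {d} → BlocksOK d π → BlocksOK d σ → VisitCountsOK d
  blocksOK⇒visitCountsOK okπ okσ p p<2n with parityView p
  ... | even i = let u = fromℕ< (double-cancel-< p<2n) in
    subst (Cong1 _) (trans (blockSize-π u) (cong (visitCount ∘ double) (toℕ-fromℕ< _))) (okπ u)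
  ... | odd i  = let u = fromℕ< (double-cancel-< (<⇒≤ p<2n)) in
    subst (Cong1 _) (trans (blockSize-σ u) (cong (visitCount ∘ suc ∘ double) (toℕ-fromℕ< _))) (okσ u)

  visitCountsOK⇒blocksOK : ∀ {d} → VisitCountsOK d → BlocksOK d π × BlocksOK d σ
  visitCountsOK⇒blocksOK ok =
    (λ i → subst (Cong1 _) (sym (blockSize-π i)) (ok _ (position<double (i , false)))) ,
    (λ i → subst (Cong1 _) (sym (blockSize-σ i)) (ok _ (position<double (i , true))))

-- The Dyck path of a noncrossing partition

record IsNCPartition (_~_ : ℕ → ℕ → Set) (n : ℕ) : Set where
  field
    bounded     : ∀ {i j} → i ~ j → i < n × j < n
    reflexive   : ∀ {i} → i < n → i ~ i
    symmetric   : ∀ {i j} → i ~ j → j ~ i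
    transitive  : ∀ {i j k} → i ~ j → j ~ k → i ~ k
    noncrossing : ∀ {a b c e} → a < b → b < c → c < e → a ~ c → b ~ e → a ~ b

module NCPath {_~_ : ℕ → ℕ → Set} (_~?_ : ∀ i j → Dec (i ~ j)) (n : ℕ) where

  HasLater : ℕ → Set
  HasLater i = ∃ λ j → j < n × (i < j × i ~ j)

  HasEarlier : ℕ → Set
  HasEarlier i = ∃ λ j → j < i × i ~ j

  Closes : ℕ → Set
  Closes i = ¬ HasLater i × ¬ i ~ 0

  Opens : ℕ → Set
  Opens i = ¬ HasEarlier (suc i) × suc i < n

  hasLater? : ∀ i → Dec (HasLater i)
  hasLater? i = anyUpTo? (λ j → (i <? j) ×-dec (i ~? j)) n

  closes? : ∀ i → Dec (Closes i)
  closes? i = ¬? (hasLater? i) ×-dec ¬? (i ~? 0)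

  opens? : ∀ i → Dec (Opens i)
  opens? i = ¬? (anyUpTo? (suc i ~?_) (suc i)) ×-dec (suc i <? n)

  -- e i and o i are the heights at the positions 2i and 2i+1: the walk steps down after 2i
  -- when i closes a block other than the root block, and up after 2i+1 when suc i opens one.
  mutual
    e : ℕ → ℕ
    e zero    = 0
    e (suc i) = if does (opens? i) then suc (o i) else pred (o i)

    o : ℕ → ℕ
    o i = if does (closes? i) then pred (e i) else suc (e i)

  H : ℕ → ℕ
  H = interleave e o

  o-closes : ∀ {i} → Closes i → o i ≡ pred (e i)
  o-closes {i} c rewrite dec-true (closes? i) c = refl

  o-continues : ∀ {i} → ¬ Closes i → o i ≡ suc (e i)
  o-continues {i} ¬c rewrite dec-false (closes? i) ¬c = refl

  e-opens : ∀ {i} → Opens i → e (suc i) ≡ suc (o i)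
  e-opens {i} op rewrite dec-true (opens? i) op = refl

  e-continues : ∀ {i} → ¬ Opens i → e (suc i) ≡ pred (o i)
  e-continues {i} ¬op rewrite dec-false (opens? i) ¬op = refl

  e-joins : ∀ {j} → 0 < j → HasEarlier j → e j ≡ pred (o (pred j))
  e-joins {suc j} _ earlier = e-continues (λ (¬earlier , _) → ¬earlier earlier)

  Closed : ℕ → ℕ → Set
  Closed x y = ∀ {a b} → x ≤ a → a < y → a ~ b → x ≤ b × b < y

  -- Heights strictly between positions 2x+1 and 2y-1 stay above o x, and return to it.
  Excursion : ℕ → ℕ → Set
  Excursion x y = (∀ i → x < i → i < y → suc (o x) ≤ e i × o x ≤ o i) × o (pred y) ≡ o x

  RootBounds : Set
  RootBounds = (∀ i → i < n → 1 ≤ o i × (¬ i ~ 0 → 1 ≤ e i)) × o (pred n) ≡ 1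

  module Properties (P : IsNCPartition _~_ n) where
    open IsNCPartition P

    nextInBlock : ∀ {c} → HasLater c →
                  ∃ λ c′ → c < c′ × c′ < n × c ~ c′ × (∀ j → c < j → j < c′ → ¬ c ~ j)
    nextInBlock {c} (j , j<n , c<j , c~j) with leastWitness (λ j → (c <? j) ×-dec (c ~? j)) (c<j , c~j)
    ... | c′ , c′≤j , (c<c′ , c~c′) , below =
      c′ , c<c′ , ≤-<-trans c′≤j j<n , c~c′ , λ i c<i i<c′ c~i → below i i<c′ (c<i , c~i)

    gap-closed : ∀ {c c′} → c ~ c′ → c < c′ → (∀ j → c < j → j < c′ → ¬ c ~ j) → Closed (suc c) c′
    gap-closed {c} {c′} c~c′ c<c′ empty {a} {b} c<a a<c′ a~b with <-cmp b c | <-cmp b c′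
    ... | tri< b<c _ _ | _ =
      ⊥-elim (empty a c<a a<c′ (transitive (symmetric (noncrossing b<c c<a a<c′ (symmetric a~b) c~c′)) (symmetric a~b)))
    ... | tri≈ _ refl _ | _ = ⊥-elim (empty a c<a a<c′ (symmetric a~b))
    ... | tri> _ _ c<b | tri< b<c′ _ _ = c<b , b<c′
    ... | tri> _ _ _ | tri≈ _ refl _ = ⊥-elim (empty a c<a a<c′ (transitive c~c′ (symmetric a~b)))
    ... | tri> _ _ _ | tri> _ _ c′<b = ⊥-elim (empty a c<a a<c′ (noncrossing c<a a<c′ c′<b c~c′ a~b))

    after-last-closed : ∀ {x c y} → Closed x y → x ~ c → x ≤ c → c < y → ¬ HasLater c → Closed (suc c) y
    after-last-closed {x} {c} {y} closed x~c x≤c c<y noLater {a} {b} c<a a<y a~b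
      with closed (≤-trans x≤c (<⇒≤ c<a)) a<y a~b
    ... | x≤b , b<y with <-cmp b c
    ... | tri> _ _ c<b = c<b , b<y
    ... | tri≈ _ refl _ = ⊥-elim (noLater (a , proj₁ (bounded a~b) , c<a , symmetric a~b))
    ... | tri< b<c _ _ = ⊥-elim (noLater (a , proj₁ (bounded a~b) , c<a , c~a))
      where
      c~a : c ~ a
      c~a with m≤n⇒m<n∨m≡n x≤b
      ... | inj₂ refl = transitive (symmetric x~c) (symmetric a~b)
      ... | inj₁ x<b  = transitive (symmetric x~c) (transitive (noncrossing x<b b<c c<a x~c (symmetric a~b)) (symmetric a~b))

    weaken : ∀ {u v} → u ≤ v → ∀ {i} → suc v ≤ e i × v ≤ o i → suc u ≤ e i × u ≤ o i
    weaken u≤v (above-e , above-o) = ≤-trans (s≤s u≤v) above-e , ≤-trans u≤v above-o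

    -- The recursion walks along the block of suc x, treating each gap by a
    -- shorter excursion; k bounds the length still to be walked.
    mutual
      excursion-fuel : ∀ k {x y} → y ≤ suc x + k → x < y → y ≤ n → Closed (suc x) y → Excursion x y
      excursion-fuel k {x} {y} y≤ x<y y≤n closed with m≤n⇒m<n∨m≡n x<y
      ... | inj₂ refl  = (λ i x<i i<y → ⊥-elim (<⇒≱ i<y x<i)) , refl
      ... | inj₁ x+1<y = walk k y≤ y≤n closed (reflexive (<-≤-trans x+1<y y≤n)) ≤-refl x+1<y
                              (e-opens (first , <-≤-trans x+1<y y≤n)) (λ i x<i i<x+1 → ⊥-elim (<⇒≱ i<x+1 x<i))
        where
        first : ¬ HasEarlier (suc x)
        first (j , j≤x , x+1~j) = <⇒≱ (s≤s⁻¹ (s≤s j≤x)) (proj₁ (closed ≤-refl x+1<y x+1~j))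

      walk : ∀ k {x c y} → y ≤ c + k → y ≤ n → Closed (suc x) y →
             suc x ~ c → suc x ≤ c → c < y → e c ≡ suc (o x) →
             (∀ i → x < i → i < c → suc (o x) ≤ e i × o x ≤ o i) → Excursion x y
      walk zero {c = c} y≤c+0 _ _ _ _ c<y _ _ = ⊥-elim (<⇒≱ c<y (subst (_ ≤_) (+-identityʳ c) y≤c+0))
      walk (suc k) {x} {c} {y} y≤ y≤n closed x+1~c x<c c<y ec≡ before with hasLater? c
      ... | no noLater = bounds , trans (proj₂ rest) oc≡
        where
        c≁0 : ¬ c ~ 0
        c≁0 c~0 = case proj₁ (closed x<c c<y c~0) of λ ()
        oc≡ : o c ≡ o x
        oc≡ = trans (o-closes (noLater , c≁0)) (cong pred ec≡)
        rest : Excursion c y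
        rest = excursion-fuel k (subst (y ≤_) (+-suc c k) y≤) c<y y≤n
                              (after-last-closed closed x+1~c x<c c<y noLater)
        bounds : ∀ i → x < i → i < y → suc (o x) ≤ e i × o x ≤ o i
        bounds i x<i i<y with <-cmp i c
        ... | tri< i<c _ _ = before i x<i i<c
        ... | tri≈ _ refl _ = ≤-reflexive (sym ec≡) , ≤-reflexive (sym oc≡)
        ... | tri> _ _ c<i = weaken (≤-reflexive (sym oc≡)) (proj₁ rest i c<i i<y)
      ... | yes later with nextInBlock later
      ...   | c′ , c<c′ , c′<n , c~c′ , empty =
        walk k (≤-trans y≤ (subst (_≤ c′ + k) (sym (+-suc c k)) (+-monoˡ-≤ k c<c′))) y≤n closed
             (transitive x+1~c c~c′) (≤-trans x<c (<⇒≤ c<c′)) c′<y ec′≡ bounds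
        where
        c′<y : c′ < y
        c′<y = proj₂ (closed x<c c<y c~c′)
        oc≡ : o c ≡ suc (suc (o x))
        oc≡ = trans (o-continues (λ (noLater , _) → noLater later)) (cong suc ec≡)
        gap : Excursion c c′
        gap = excursion-fuel k (subst (c′ ≤_) (+-suc c k) (<⇒≤ (<-≤-trans c′<y y≤))) c<c′ (<⇒≤ c′<n)
                             (gap-closed c~c′ c<c′ empty)
        ec′≡ : e c′ ≡ suc (o x)
        ec′≡ = trans (e-joins (≤-<-trans z≤n c<c′) (c , c<c′ , symmetric c~c′)) (cong pred (trans (proj₂ gap) oc≡))
        bounds : ∀ i → x < i → i < c′ → suc (o x) ≤ e i × o x ≤ o i
        bounds i x<i i<c′ with <-cmp i c
        ... | tri< i<c _ _ = before i x<i i<c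
        ... | tri≈ _ refl _ = ≤-reflexive (sym ec≡) , ≤-trans (n≤1+n _) (≤-trans (n≤1+n _) (≤-reflexive (sym oc≡)))
        ... | tri> _ _ c<i = weaken (≤-trans (n≤1+n _) (≤-trans (n≤1+n _) (≤-reflexive (sym oc≡)))) (proj₁ gap i c<i i<c′)

    excursion : ∀ {x y} → x < y → y ≤ n → Closed (suc x) y → Excursion x y
    excursion {x} x<y y≤n = excursion-fuel n (≤-trans y≤n (m≤n+m n (suc x))) x<y y≤n

    closed-all : Closed 0 n
    closed-all _ _ a~b = z≤n , proj₂ (bounded a~b)

    rootWalk : ∀ k {c} → n ≤ c + k → 0 ~ c → c < n → e c ≡ 0 →
               (∀ i → i < c → 1 ≤ o i × (¬ i ~ 0 → 1 ≤ e i)) → RootBounds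
    rootWalk zero {c} n≤c+0 _ c<n _ _ = ⊥-elim (<⇒≱ c<n (subst (n ≤_) (+-identityʳ c) n≤c+0))
    rootWalk (suc k) {c} n≤ 0~c c<n ec≡0 before with hasLater? c
    ... | no noLater = bounds , trans (proj₂ rest) oc≡1
      where
      oc≡1 : o c ≡ 1
      oc≡1 = trans (o-continues (λ (_ , c≁0) → c≁0 (symmetric 0~c))) (cong suc ec≡0)
      rest : Excursion c n
      rest = excursion c<n ≤-refl (after-last-closed closed-all 0~c z≤n c<n noLater)
      bounds : ∀ i → i < n → 1 ≤ o i × (¬ i ~ 0 → 1 ≤ e i)
      bounds i i<n with <-cmp i c
      ... | tri< i<c _ _ = before i i<c
      ... | tri≈ _ refl _ = ≤-reflexive (sym oc≡1) , λ c≁0 → ⊥-elim (c≁0 (symmetric 0~c))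
      ... | tri> _ _ c<i = let above-e , above-o = proj₁ rest i c<i i<n
                           in ≤-trans (≤-reflexive (sym oc≡1)) above-o , λ _ → ≤-trans (s≤s z≤n) above-e
    ... | yes later with nextInBlock later
    ...   | c′ , c<c′ , c′<n , c~c′ , empty =
      rootWalk k (≤-trans n≤ (subst (_≤ c′ + k) (sym (+-suc c k)) (+-monoˡ-≤ k c<c′)))
               (transitive 0~c c~c′) c′<n ec′≡0 bounds
      where
      oc≡1 : o c ≡ 1
      oc≡1 = trans (o-continues (λ (_ , c≁0) → c≁0 (symmetric 0~c))) (cong suc ec≡0)
      gap : Excursion c c′
      gap = excursion c<c′ (<⇒≤ c′<n) (gap-closed c~c′ c<c′ empty)
      ec′≡0 : e c′ ≡ 0
      ec′≡0 = trans (e-joins (≤-<-trans z≤n c<c′) (c , c<c′ , symmetric c~c′)) (cong pred (trans (proj₂ gap) oc≡1))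
      bounds : ∀ i → i < c′ → 1 ≤ o i × (¬ i ~ 0 → 1 ≤ e i)
      bounds i i<c′ with <-cmp i c
      ... | tri< i<c _ _ = before i i<c
      ... | tri≈ _ refl _ = ≤-reflexive (sym oc≡1) , λ c≁0 → ⊥-elim (c≁0 (symmetric 0~c))
      ... | tri> _ _ c<i = let above-e , above-o = proj₁ gap i c<i i<c′
                           in ≤-trans (≤-reflexive (sym oc≡1)) above-o , λ _ → ≤-trans (s≤s z≤n) above-e

    rootBounds : 0 < n → RootBounds
    rootBounds 0<n = rootWalk n ≤-refl (reflexive 0<n) 0<n refl (λ _ ())

    consecutive⇒sameVertex : ∀ {a b} → a ~ b → a < b → (∀ j → a < j → j < b → ¬ a ~ j) →
                             SameVertex H (double a) (double b)
    consecutive⇒sameVertex {a} {b} a~b a<b empty =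
      trans (interleave-double e o a) (trans (sym eb≡ea) (sym (interleave-double e o b))) ,
      λ s btw → let 2a≤s , s≤2b = between-ordered (double-mono-≤ (<⇒≤ a<b)) btw in low s 2a≤s s≤2b
      where
      gap : Excursion a b
      gap = excursion a<b (<⇒≤ (proj₂ (bounded a~b))) (gap-closed a~b a<b empty)
      oa≡ : o a ≡ suc (e a)
      oa≡ = o-continues λ (noLater , _) → noLater (b , proj₂ (bounded a~b) , a<b , a~b)
      eb≡ea : e b ≡ e a
      eb≡ea = trans (e-joins (≤-<-trans z≤n a<b) (a , a<b , symmetric a~b)) (cong pred (trans (proj₂ gap) oa≡))
      ea≤oa : e a ≤ o a
      ea≤oa = ≤-trans (n≤1+n _) (≤-reflexive (sym oa≡))
      low : ∀ s → double a ≤ s → s ≤ double b → H (double a) ≤ H s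
      low s 2a≤s s≤2b rewrite interleave-double e o a with parityView s
      ... | even i rewrite interleave-double e o i with <-cmp a i | <-cmp i b
      ...   | tri≈ _ refl _ | _             = ≤-refl
      ...   | tri< a<i _ _  | tri< i<b _ _  = ≤-trans ea≤oa (<⇒≤ (proj₁ (proj₁ gap i a<i i<b)))
      ...   | tri< _ _ _    | tri≈ _ refl _ = ≤-reflexive (sym eb≡ea)
      ...   | tri< _ _ _    | tri> _ _ b<i  = ⊥-elim (<⇒≱ (double-mono-< b<i) s≤2b)
      ...   | tri> _ _ i<a  | _             = ⊥-elim (<⇒≱ (double-mono-< i<a) 2a≤s)
      low s 2a≤s s≤2b | odd i rewrite interleave-suc-double e o i with <-cmp a i
      ...   | tri≈ _ refl _ = ea≤oa
      ...   | tri< a<i _ _  = ≤-trans ea≤oa (proj₂ (proj₁ gap i a<i (double-cancel-< s≤2b)))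
      ...   | tri> _ _ i<a  = ⊥-elim (<⇒≱ (s≤s (double-cancel-≤ 2a≤s)) i<a)

    private
      chain : ∀ k {i j} → j ≤ i + k → i ≤ j → i ~ j → SameVertex H (double i) (double j)
      chain k {i} {j} j≤ i≤j i~j with m≤n⇒m<n∨m≡n i≤j
      ... | inj₂ refl = sameVertex-refl H (double i)
      ... | inj₁ i<j with k | nextInBlock (j , proj₂ (bounded i~j) , i<j , i~j)
      ...   | zero  | _ = ⊥-elim (<⇒≱ i<j (subst (j ≤_) (+-identityʳ i) j≤))
      ...   | suc k | c , i<c , _ , i~c , empty =
        sameVertex-trans H (consecutive⇒sameVertex i~c i<c empty)
                           (chain k (≤-trans j≤ (subst (_≤ c + k) (sym (+-suc i k)) (+-monoˡ-≤ k i<c))) c≤j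
                                  (transitive (symmetric i~c) i~j))
        where
        c≤j : c ≤ j
        c≤j = ≮⇒≥ λ j<c → empty j i<j j<c i~j

    sameBlock⇒sameVertex : ∀ {i j} → i ~ j → SameVertex H (double i) (double j)
    sameBlock⇒sameVertex {i} {j} i~j with ≤-total i j
    ... | inj₁ i≤j = chain j (m≤n+m j i) i≤j i~j
    ... | inj₂ j≤i = sameVertex-sym H (chain i (m≤n+m i j) j≤i (symmetric i~j))

    e-sameBlock : ∀ {i j} → i ~ j → e i ≡ e j
    e-sameBlock {i} {j} i~j = trans (sym (interleave-double e o i)) (trans (proj₁ (sameBlock⇒sameVertex i~j)) (interleave-double e o j))

    e-raised : ∀ {a j} → a < j → HasLater a → (∀ m → a < m → m ≤ j → ¬ a ~ m) → e a < e j
    e-raised {a} {j} a<j later none with nextInBlock later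
    ... | b , a<b , b<n , a~b , empty =
      ≤-trans (s≤s (≤-trans (n≤1+n _) (≤-reflexive (sym oa≡)))) (proj₁ (proj₁ gap j a<j j<b))
      where
      j<b : j < b
      j<b = ≰⇒> λ b≤j → none b a<b b≤j a~b
      gap : Excursion a b
      gap = excursion a<b (<⇒≤ b<n) (gap-closed a~b a<b empty)
      oa≡ : o a ≡ suc (e a)
      oa≡ = o-continues λ (noLater , _) → noLater later

    module _ (0<n : 0 < n) where

      private
        o-positive : ∀ {i} → i < n → 1 ≤ o i
        o-positive i<n = proj₁ (proj₁ (rootBounds 0<n) _ i<n)

        e-positive : ∀ {i} → i < n → ¬ i ~ 0 → 1 ≤ e i
        e-positive i<n = proj₂ (proj₁ (rootBounds 0<n) _ i<n)

        H-double : ∀ i → H (double i) ≡ e i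
        H-double = interleave-double e o

      -- With a the last element of the block of i before j: either the block
      -- continues past j, so that j lies in a higher excursion, or the walk
      -- steps down right after 2a, or the block is the root block, at height 0.
      differentBlock⇒¬sameVertex : ∀ {i j} → i ≤ j → j < n → ¬ i ~ j → ¬ SameVertex H (double i) (double j)
      differentBlock⇒¬sameVertex {i} {j} i≤j j<n i≁j with m≤n⇒m<n∨m≡n i≤j
      ... | inj₂ refl = λ _ → i≁j (reflexive j<n)
      ... | inj₁ i<j with greatestBelow (i ~?_) j i<j (reflexive (<-trans i<j j<n))
      ...   | a , i≤a , a<j , i~a , none with hasLater? a | a ~? 0
      ...     | yes later | _ = λ (hi≡hj , _) →
        <⇒≢ (e-raised a<j later beyond) (trans (sym (e-sameBlock i~a)) (trans (sym (H-double i)) (trans hi≡hj (H-double j))))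
        where
        beyond : ∀ m → a < m → m ≤ j → ¬ a ~ m
        beyond m a<m m≤j a~m with m≤n⇒m<n∨m≡n m≤j
        ... | inj₁ m<j  = none m a<m m<j (transitive i~a a~m)
        ... | inj₂ refl = i≁j (transitive i~a a~m)
      ...     | no noLater | yes a~0 = λ (hi≡hj , _) →
        <⇒≢ (e-positive j<n j≁0)
            (sym (trans (sym (H-double j)) (trans (sym hi≡hj) (trans (H-double i) (e-sameBlock (transitive i~a a~0))))))
        where
        j≁0 : ¬ j ~ 0
        j≁0 j~0 = i≁j (transitive (transitive i~a a~0) (symmetric j~0))
      ...     | no noLater | no a≁0 =
        sameVertex-blocked H (inj₁ (≤-trans (double-mono-≤ i≤a) (n≤1+n _) , double-mono-< a<j)) drop
        where
        pred< : ∀ {x} → 1 ≤ x → pred x < x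
        pred< {suc x} _ = ≤-refl
        drop : H (suc (double a)) < H (double i)
        drop = subst₂ _<_ (sym (trans (interleave-suc-double e o a) (o-closes (noLater , a≁0))))
                          (sym (trans (H-double i) (e-sameBlock i~a)))
                          (pred< (e-positive (<-trans a<j j<n) a≁0))

      sameVertex⇒sameBlock : ∀ {i j} → i < n → j < n → SameVertex H (double i) (double j) → i ~ j
      sameVertex⇒sameBlock {i} {j} i<n j<n s with i ~? j | ≤-total i j
      ... | yes i~j | _       = i~j
      ... | no i≁j  | inj₁ i≤j = ⊥-elim (differentBlock⇒¬sameVertex i≤j j<n i≁j s)
      ... | no i≁j  | inj₂ j≤i = ⊥-elim (differentBlock⇒¬sameVertex j≤i i<n (i≁j ∘ symmetric) (sameVertex-sym H s))

      isDyck : IsDyck H (double n)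
      isDyck = record { start = refl ; end = end′ ; step = step′ }
        where
        end′ : H (double n) ≡ 0
        end′ = trans (H-double n) (trans (cong e (sym 1+pred-n≡n)) (trans (e-continues last) (cong pred (proj₂ (rootBounds 0<n)))))
          where
          1+pred-n≡n : suc (pred n) ≡ n
          1+pred-n≡n = suc-pred n {{>-nonZero 0<n}}
          last : ¬ Opens (pred n)
          last (_ , n<n) = <-irrefl 1+pred-n≡n n<n
        step′ : ∀ p → p < double n → Step H p
        step′ p p<2n with parityView p
        ... | even i rewrite H-double i | interleave-suc-double e o i with closes? i
        ...   | yes closes =
          inj₂ (trans (sym (suc-pred (e i) {{>-nonZero (e-positive i<n (proj₂ closes))}})) (cong suc (sym (o-closes closes))))
          where
          i<n : i < n
          i<n = double-cancel-< p<2n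
        ...   | no ¬closes = inj₁ (o-continues ¬closes)
        step′ p p<2n | odd i rewrite interleave-suc-double e o i | H-double (suc i) with opens? i
        ...   | yes opens  = inj₁ (e-opens opens)
        ...   | no ¬opens  = inj₂ (trans (sym (suc-pred (o i) {{>-nonZero (o-positive i<n)}})) (cong suc (sym (e-continues ¬opens))))
          where
          i<n : i < n
          i<n = double-cancel-< (≤-trans (n≤1+n _) p<2n)

  -- A Dyck path whose even positions visit the same vertex exactly along the
  -- blocks of _~_ is H: each step is forced by the blocks.
  module Unique {h : ℕ → ℕ} (D : IsDyck h (double n))
                (sound : ∀ {i j} → i ~ j → SameVertex h (double i) (double j))
                (complete : ∀ {i j} → i < n → j < n → SameVertex h (double i) (double j) → i ~ j) where

    private
      evenPosition : ∀ {b i} → b ≤ double n → h b ≡ h (double i) → i ≤ n → ∃ λ j → b ≡ double j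
      evenPosition {b} {i} b≤2n hb≡ i≤n = even⇒double
        (trans (sym (height-parity D b b≤2n))
               (trans (cong parity hb≡) (trans (height-parity D (double i) (double-mono-≤ i≤n)) (parity-double i))))

    o-matches : ∀ {i} → i < n → e i ≡ h (double i) → o i ≡ h (suc (double i))
    o-matches {i} i<n ei≡ with step D (double i) (double-mono-< i<n)
    ... | inj₁ up = trans (o-continues ¬closes) (trans (cong suc ei≡) (sym up))
      where
      ¬closes : ¬ Closes i
      ¬closes (noLater , i≁0) with h (double i) ≟ 0
      ... | yes hi≡0 = i≁0 (complete i<n (≤-<-trans z≤n i<n) (sameVertex-ground h hi≡0 (start D)))
      ... | no hi≢0 with firstVisit D ≤-refl (<⇒≤ (double-mono-≤ i<n)) (subst (h (double i) <_) (sym up) ≤-refl)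
                                     (subst (_≤ h (double i)) (sym (end D)) z≤n)
      ...   | b , 2i+1<b , b≤2n , hb≡ , above with evenPosition b≤2n hb≡ (<⇒≤ i<n)
      ...     | j , refl = noLater (j , j<n , double-cancel-< (<⇒≤ 2i+1<b) , complete i<n j<n same)
        where
        j<n : j < n
        j<n = double-cancel-< (≤∧≢⇒< b≤2n λ 2j≡2n → hi≢0 (trans (sym hb≡) (trans (cong h 2j≡2n) (end D))))
        same : SameVertex h (double i) (double j)
        same = sameVertex-bridge h (n≤1+n _) (<⇒≤ 2i+1<b) refl hb≡
                 (λ s 2i<s s≤2i+1 → subst (λ s → h (double i) < h s) (≤-antisym 2i<s s≤2i+1)
                                          (subst (h (double i) <_) (sym up) ≤-refl))
                 above
    ... | inj₂ down = trans (o-closes (noLater , i≁0)) (trans (cong pred ei≡) (cong pred down))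
      where
      lower : h (suc (double i)) < h (double i)
      lower = subst (h (suc (double i)) <_) (sym down) ≤-refl
      noLater : ¬ HasLater i
      noLater (j , _ , i<j , i~j) = sameVertex-blocked h (inj₁ (n≤1+n _ , double-mono-< i<j)) lower (sound i~j)
      i≁0 : ¬ i ~ 0
      i≁0 i~0 = 0≢1+n (trans (sym (trans (proj₁ (sound i~0)) (start D))) down)

    e-matches : ∀ {i} → i < n → o i ≡ h (suc (double i)) → e (suc i) ≡ h (double (suc i))
    e-matches {i} i<n oi≡ with step D (suc (double i)) (double-mono-≤ i<n)
    ... | inj₁ up = trans (e-opens (noEarlier , i+1<n)) (trans (cong suc oi≡) (sym up))
      where
      i+1<n : suc i < n
      i+1<n = ≤∧≢⇒< i<n λ i+1≡n → 0≢1+n (trans (sym (trans (cong (h ∘ double) i+1≡n) (end D))) up)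
      noEarlier : ¬ HasEarlier (suc i)
      noEarlier (j , j<i+1 , i+1~j) =
        sameVertex-blocked h (inj₂ (≤-trans (double-mono-≤ (s≤s⁻¹ j<i+1)) (n≤1+n _) , n≤1+n _))
                           (subst (h (suc (double i)) <_) (sym up) ≤-refl) (sound i+1~j)
    ... | inj₂ down = trans (e-continues ¬opens) (trans (cong pred oi≡) (cong pred down))
      where
      v : ℕ
      v = h (double (suc i))
      ¬opens : ¬ Opens i
      ¬opens (noEarlier , i+1<n)
        with lastVisit D (<⇒≤ (double-mono-≤ i<n)) z≤n (subst (_≤ v) (sym (start D)) z≤n) (subst (v <_) (sym down) ≤-refl)
      ... | a , _ , a<2i+1 , ha≡v , above with evenPosition (≤-trans (<⇒≤ a<2i+1) (<⇒≤ (double-mono-≤ i<n))) ha≡v (<⇒≤ i+1<n)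
      ...   | j , refl = noEarlier (j , s≤s (double-cancel-≤ (<⇒≤ a<2i+1)) ,
                                    complete i+1<n (<-≤-trans (s≤s (double-cancel-≤ (<⇒≤ a<2i+1))) i<n)
                                             (sameVertex-sym h same))
        where
        same : SameVertex h (double j) (double (suc i))
        same = sameVertex-bridge h (<⇒≤ a<2i+1) (n≤1+n _) ha≡v refl above
                 (λ s 2i+1≤s s<2i+2 → subst (λ s → v < h s) (≤-antisym 2i+1≤s (s≤s⁻¹ s<2i+2))
                                            (subst (v <_) (sym down) ≤-refl))

    e-matches-all : ∀ i → i ≤ n → e i ≡ h (double i)
    e-matches-all zero    _   = sym (start D)
    e-matches-all (suc i) i<n = e-matches i<n (o-matches i<n (e-matches-all i (<⇒≤ i<n)))

    H≗h : ∀ p → p ≤ double n → H p ≡ h p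
    H≗h p p≤2n with parityView p
    ... | even i = trans (interleave-double e o i) (e-matches-all i (double-cancel-≤ (m≤n⇒m≤1+n p≤2n)))
    ... | odd i  = trans (interleave-suc-double e o i) (o-matches i<n (e-matches-all i (<⇒≤ i<n)))
      where
      i<n : i < n
      i<n = double-cancel-< p≤2n

isDyck? : ∀ h N → Dec (IsDyck h N)
isDyck? h N = map′ (λ ((s , e) , st) → record { start = s ; end = e ; step = λ p → st {p} })
                   (λ D → (start D , end D) , λ {p} → step D p)
                   (((h 0 ≟ 0) ×-dec (h N ≟ 0)) ×-dec
                    allUpTo? (λ p → (h (suc p) ≟ suc (h p)) ⊎-dec (h p ≟ suc (h (suc p)))) N)

EntryRel : ∀ {n} → Matrix n → ℕ → ℕ → Set
EntryRel π i j = entry π i j ≡ true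

entryRel? : ∀ {n} (π : Matrix n) i j → Dec (EntryRel π i j)
entryRel? π i j = entry π i j Bool.≟ true

isNCPartition : ∀ {n} {π : Matrix n} → IsPartition π → Noncrossing π → IsNCPartition (EntryRel π) n
isNCPartition {n} {π} (refl′ , sym′ , trans′) nc = record
  { bounded     = λ {i} {j} → entry-bounded π i j
  ; reflexive   = λ i<n → trans (entry-fromℕ< π i<n i<n) (refl′ _)
  ; symmetric   = λ {i} {j} r → let i<n , j<n = entry-bounded π i j r in
                    trans (entry-fromℕ< π j<n i<n) (sym′ _ _ (toRel i<n j<n r))
  ; transitive  = λ {i} {j} {k} r s → let i<n , j<n = entry-bounded π i j r ; _ , k<n = entry-bounded π j k s in
                    trans (entry-fromℕ< π i<n k<n) (trans′ _ (fromℕ< j<n) _ (toRel i<n j<n r) (toRel j<n k<n s))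
  ; noncrossing = λ {a} {b} {c} {e} a<b b<c c<e r s →
                    let a<n , c<n = entry-bounded π a c r ; b<n , e<n = entry-bounded π b e s in
                    trans (entry-fromℕ< π a<n b<n)
                          (nc _ _ _ _ (toℕ< a<n b<n a<b) (toℕ< b<n c<n b<c) (toℕ< c<n e<n c<e) (toRel a<n c<n r) (toRel b<n e<n s))
  }
  where
  toRel : ∀ {i j} (i<n : i < n) (j<n : j < n) → EntryRel π i j → Rel π (fromℕ< i<n) (fromℕ< j<n)
  toRel i<n j<n r = trans (sym (entry-fromℕ< π i<n j<n)) r
  toℕ< : ∀ {i j} (i<n : i < n) (j<n : j < n) → i < j → toℕ (fromℕ< i<n) < toℕ (fromℕ< j<n)
  toℕ< i<n j<n = subst₂ _<_ (sym (toℕ-fromℕ< i<n)) (sym (toℕ-fromℕ< j<n))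

heightOf : ∀ {n} → Matrix n → ℕ → ℕ
heightOf {n} π = NCPath.H (entryRel? π) n

entry-vertexMatrix : ∀ h f {n i j} → i < n → j < n → entry (vertexMatrix h f n) i j ≡ sameVertexᵇ h (f i) (f j)
entry-vertexMatrix h f i<n j<n =
  trans (entry-fromℕ< (vertexMatrix h f _) i<n j<n)
        (trans (lookup-vertexMatrix h f _ _)
               (cong₂ (λ a b → sameVertexᵇ h (f a) (f b)) (toℕ-fromℕ< i<n) (toℕ-fromℕ< j<n)))

module FromNC {n} (π : Matrix n) (P : IsPartition π) (NC : Noncrossing π) (0<n : 0 < n) where
  open NCPath (entryRel? π) n
  open Properties (isNCPartition {π = π} P NC)

  heightOf-isDyck : IsDyck (heightOf π) (double n)
  heightOf-isDyck = isDyck 0<n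

  vertexMatrix-heightOf : ∀ h → (∀ p → p ≤ double n → h p ≡ heightOf π p) → vertexMatrix h double n ≡ π
  vertexMatrix-heightOf h h≗H = matrix-ext (vertexMatrix h double n) π λ i j → begin
    lookup (lookup (vertexMatrix h double n) i) j
      ≡⟨ lookup-vertexMatrix h double i j ⟩
    sameVertexᵇ h (double (toℕ i)) (double (toℕ j))
      ≡⟨ sameVertexᵇ-shift h H (λ s s≤ → h≗H s s≤) (pos≤ i) (pos≤ j) ⟩
    sameVertexᵇ H (double (toℕ i)) (double (toℕ j))
      ≡⟨ bool-ext (sameVertex⇒sameBlock 0<n (toℕ<n i) (toℕ<n j) ∘ does⇒ (sameVertex? H _ _))
                  (dec-true (sameVertex? H _ _) ∘ sameBlock⇒sameVertex) ⟩
    entry π (toℕ i) (toℕ j)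
      ≡⟨ entry-lookup π i j ⟩
    lookup (lookup π i) j ∎
    where
    open ≡-Reasoning
    pos≤ : ∀ (i : Fin n) → double (toℕ i) ≤ double n
    pos≤ i = <⇒≤ (double-mono-< (toℕ<n i))

module FromForest (ts : List Tree) {n} (len : sizes ts ≡ n) where

  isDyck-contour : IsDyck (contour ts) (double n)
  isDyck-contour = subst (IsDyck (contour ts) ∘ double) len (contour-isDyck ts)

  open FromDyck isDyck-contour public

  heightOf-π : ∀ p → p ≤ double n → heightOf π p ≡ contour ts p
  heightOf-π = NCPath.Unique.H≗h (entryRel? π) n isDyck-contour sound complete
    where
    sound : ∀ {i j} → EntryRel π i j → SameVertex (contour ts) (double i) (double j)
    sound {i} {j} r = let i<n , j<n = entry-bounded π i j r in
      does⇒ (sameVertex? (contour ts) _ _) (trans (sym (entry-vertexMatrix (contour ts) double i<n j<n)) r)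
    complete : ∀ {i j} → i < n → j < n → SameVertex (contour ts) (double i) (double j) → EntryRel π i j
    complete i<n j<n s = trans (entry-vertexMatrix (contour ts) double i<n j<n) (dec-true (sameVertex? (contour ts) _ _) s)

  private
    h : ℕ → ℕ
    h = contour ts

    visits≡ : ∀ p → visits ts p ≡ visitCount p + indicator (sameVertexᵇ h p (double n))
    visits≡ p = trans (cong (count (sameVertexᵇ h p) ∘ suc ∘ double) len) (count-suc (sameVertexᵇ h p) (double n))

  visitCount-root : ∀ {p} → h p ≡ 0 → visitCount p ≡ length ts
  visitCount-root {p} hp≡0 = suc-injective (begin
    suc (visitCount p)                                     ≡⟨ +-comm 1 _ ⟩
    visitCount p + 1                                       ≡⟨ cong (λ b → visitCount p + indicator b) returns ⟨
    visitCount p + indicator (sameVertexᵇ h p (double n))  ≡⟨ visits≡ p ⟨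
    visits ts p                                            ≡⟨ visits-root ts hp≡0 ⟩
    suc (length ts)                                        ∎)
    where
    open ≡-Reasoning
    returns : sameVertexᵇ h p (double n) ≡ true
    returns = dec-true (sameVertex? h p _) (sameVertex-ground h hp≡0 (end isDyck-contour))

  visitCount-nonRoot : ∀ {p} → 0 < h p → visitCount p ≡ visits ts p
  visitCount-nonRoot {p} 0<hp =
    sym (trans (visits≡ p) (trans (cong (λ b → visitCount p + indicator b) doesNotReturn) (+-identityʳ _)))
    where
    doesNotReturn : sameVertexᵇ h p (double n) ≡ false
    doesNotReturn = dec-false (sameVertex? h p _) λ (hp≡h2n , _) → <⇒≢ 0<hp (sym (trans hp≡h2n (end isDyck-contour)))

  degOK⇒visitCountsOK : ∀ {d} → DegOK d (node ts) → VisitCountsOK d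
  degOK⇒visitCountsOK (node deg oks) p p<2n with h p ≟ 0
  ... | yes hp≡0 = subst (Cong1 _) (sym (visitCount-root hp≡0)) deg
  ... | no hp≢0  = subst (Cong1 _) (sym (visitCount-nonRoot (n≢0⇒n>0 hp≢0)))
                         (allNonRootOK⇒nonRootVisitsOK ts oks p (subst (λ m → p ≤ double m) (sym len) (<⇒≤ p<2n))
                                                       (n≢0⇒n>0 hp≢0))

  visitCountsOK⇒degOK : ∀ {d} → 0 < n → VisitCountsOK d → DegOK d (node ts)
  visitCountsOK⇒degOK 0<n ok =
    node (subst (Cong1 _) (visitCount-root (contour-start ts)) (ok 0 (double-mono-< 0<n)))
         (nonRootVisitsOK⇒allNonRootOK ts λ p p≤ 0<hp → subst (Cong1 _) (visitCount-nonRoot 0<hp) (ok p (p<2n p≤ 0<hp)))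
    where
    p<2n : ∀ {p} → p ≤ double (sizes ts) → 0 < h p → p < double n
    p<2n {p} p≤ 0<hp = ≤∧≢⇒< (subst (λ m → p ≤ double m) len p≤) λ p≡2n →
      <⇒≢ 0<hp (sym (trans (cong h p≡2n) (end isDyck-contour)))

module Bijection (d n : ℕ) (0<n : 0 < n) where

  NCProperty : Matrix n → Set
  NCProperty π = IsPartition π × Noncrossing π × BlocksOK d π × (∃[ σ ] (IsKreweras π σ × BlocksOK d σ))

  TreeProperty : Tree → Set
  TreeProperty t = size t ≡ suc n × DegOK d t

  forestMatrix : List Tree → Matrix n
  forestMatrix ts = vertexMatrix (contour ts) double n

  forestMatrix-NC : ∀ ts → TreeProperty (node ts) → NCProperty (forestMatrix ts)
  forestMatrix-NC ts (size≡ , deg) =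
    vertexMatrix-isPartition (contour ts) double , π-noncrossing , proj₁ blocksOK , σ , isKreweras , proj₂ blocksOK
    where
    open FromForest ts (suc-injective size≡)
    blocksOK : BlocksOK d π × BlocksOK d σ
    blocksOK = visitCountsOK⇒blocksOK (degOK⇒visitCountsOK deg)

  forestOf : (π : Matrix n) → IsDyck (heightOf π) (double n) → List Tree
  forestOf π D = proj₁ (dyck⇒contour D)

  private
    forestOf-length : ∀ π D → sizes (forestOf π D) ≡ n
    forestOf-length π D = double-injective (proj₁ (proj₂ (dyck⇒contour D)))

    forestMatrix-forestOf : ∀ π D → IsPartition π → Noncrossing π → forestMatrix (forestOf π D) ≡ π
    forestMatrix-forestOf π D P NC =
      FromNC.vertexMatrix-heightOf π P NC 0<n (contour (forestOf π D)) (proj₂ (proj₂ (dyck⇒contour D)))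

  forestOf-tree : ∀ π D → NCProperty π → TreeProperty (node (forestOf π D))
  forestOf-tree π D (P , NC , okπ , σ′ , kreweras , okσ′) =
    cong suc (forestOf-length π D) ,
    F.visitCountsOK⇒degOK 0<n (F.blocksOK⇒visitCountsOK (subst (BlocksOK d) (sym π≡) okπ) (subst (BlocksOK d) σ′≡σ okσ′))
    where
    module F = FromForest (forestOf π D) (forestOf-length π D)
    π≡ : F.π ≡ π
    π≡ = forestMatrix-forestOf π D P NC
    σ′≡σ : σ′ ≡ F.σ
    σ′≡σ = kreweras-unique (subst (λ π → IsKreweras π σ′) (sym π≡) kreweras) F.isKreweras

  toNC : PlaneTrees d n → NCd d n
  toNC (node ts , [ pf ]) = forestMatrix ts , [ forestMatrix-NC ts pf ]

  -- The properties in NCd and PlaneTrees are irrelevant; what is needed from them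
  -- relevantly is recomputed with a decision procedure.
  heightOf-isDyck : ∀ π → .(NCProperty π) → IsDyck (heightOf π) (double n)
  heightOf-isDyck π pf =
    recompute (isDyck? (heightOf π) (double n)) (FromNC.heightOf-isDyck π (proj₁ pf) (proj₁ (proj₂ pf)) 0<n)

  toTree : NCd d n → PlaneTrees d n
  toTree (π , [ pf ]) = node (forestOf π D) , [ forestOf-tree π D pf ]
    where
    D : IsDyck (heightOf π) (double n)
    D = heightOf-isDyck π pf

  toNC∘toTree : ∀ x → toNC (toTree x) ≡ x
  toNC∘toTree (π , [ pf ]) = value-injective (recompute (≡-dec (≡-dec Bool._≟_) _ π)
    (forestMatrix-forestOf π (heightOf-isDyck π pf) (proj₁ pf) (proj₁ (proj₂ pf))))

  toTree∘toNC : ∀ t → toTree (toNC t) ≡ t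
  toTree∘toNC (node ts , [ pf ]) = value-injective (cong node (contour-injective f ts length≡ agree))
    where
    len : sizes ts ≡ n
    len = recompute (sizes ts ≟ n) (suc-injective (proj₁ pf))
    D : IsDyck (heightOf (forestMatrix ts)) (double n)
    D = heightOf-isDyck (forestMatrix ts) (forestMatrix-NC ts pf)
    f : List Tree
    f = forestOf (forestMatrix ts) D
    length≡ : double (sizes f) ≡ double (sizes ts)
    length≡ = trans (proj₁ (proj₂ (dyck⇒contour D))) (cong double (sym len))
    agree : ∀ p → p ≤ double (sizes f) → contour f p ≡ contour ts p
    agree p p≤ = let p≤2n = subst (p ≤_) (proj₁ (proj₂ (dyck⇒contour D))) p≤ in
      trans (proj₂ (proj₂ (dyck⇒contour D)) p p≤2n) (FromForest.heightOf-π ts len p p≤2n)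

-- The bijection matches the degree and block-size conditions for every d.
corollary5p9 : (d n : ℕ) → 1 ≤ d → 1 ≤ n → NCd d n ↔ PlaneTrees d n
corollary5p9 d n _ 1≤n = mk↔ₛ′ toTree toNC toTree∘toNC toNC∘toTree
  where open Bijection d n 1≤n
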